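{- Let $n \geq 6$ be an integer and let $s$ be an integer. Suppose that either (i) $n$ is even and $2-F_{n-2}-q_n \leq s \leq 2+F_{n-2}+p_n$, or (ii) $n$ is odd and $2-F_{n-2}-s_n \leq s \leq 2+F_{n-2}+r_n$, where (with $C_1,C_2,C_3,C_4$ and $e^i$ as in the context) $p_n = S(C_1^{ -2}u^n)$ with $u^n = e^1+\sum_{i=1}^{(n-2)/2} e^{2i} + e^{n-1}$ ($n$ even); $r_n = S(C_2^{ -2}v^n)$ with $v^n = e^1+\sum_{i=1}^{(n-3)/2} e^{2i} + e^{n-2}+e^{n-1}$ ($n$ odd); $q_n = -S(C_3^{ -2}w^n)$ with $w^n = \sum_{i=1}^{(n-4)/2} e^{2i+1} + e^{n-2}+e^{n-1}$ ($n$ even); $s_n = -S(C_4^{ -2}z^n)$ with $z^n = \sum_{i=1}^{(n-3)/2} e^{2i+1} + e^{n-1}$ ($n$ odd). Then there exists an $n\times n$ upper triangular, singular, group invertible matrix $A$ with all entries in $\{0,1\}$ such that $S(A^{\#})=s$.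
   Context: $F_m$ denotes the $m$-th Fibonacci number, $F_1=F_2=1$, $F_{m+1}=F_m+F_{m-1}$. For a real matrix or vector $X$, $S(X)$ denotes the sum of all its entries. For a real $n\times n$ matrix $A$, the group inverse $A^{\#}$ (when it exists) is the unique $n\times n$ matrix $X$ with $AXA=A$, $XAX=X$, $AX=XA$; $A$ is group invertible if such $X$ exists. Throughout, $e^1,\dots,e^{n-1}$ denote the standard basis vectors of $\mathbb{R}^{n-1}$, and matrices are specified by their columns $Ce^k$. For even $n\ge 6$, $C_1$ is the $(n-1)\times(n-1)$ matrix with $C_1e^1=e^1$, $C_1e^2=e^2$; for odd $k$ with $3\le k\le n-3$, $C_1e^k=e^1+\sum_{i=1}^{(k-1)/2}e^{2i}+e^k$; for even $k$ with $4\le k\le n-2$, $C_1e^k=\sum_{i=1}^{(k-2)/2}e^{2i+1}+e^k$; and $C_1e^{n-1}=\sum_{i=1}^{(n-4)/2}e^{2i+1}+e^{n-1}$. For odd $n\ge 7$, $C_2$ is the $(n-1)\times(n-1)$ matrix with $C_2e^1=e^1$, $C_2e^2=e^2$; for odd $k$ with $3\le k\le n-4$, $C_2e^k=e^1+\sum_{i=1}^{(k-1)/2}e^{2i}+e^k$; for even $k$ with $4\le k\le n-3$, $C_2e^k=\sum_{i=1}^{(k-2)/2}e^{2i+1}+e^k$; $C_2e^{n-2}=\sum_{i=1}^{(n-5)/2}e^{2i+1}+e^{n-2}$ and $C_2e^{n-1}=\sum_{i=1}^{(n-5)/2}e^{2i+1}+e^{n-1}$. For even $n\ge 6$, $C_3$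 is the $(n-1)\times(n-1)$ matrix with $C_3e^1=e^1$, $C_3e^2=e^2$; for odd $k$ with $3\le k\le n-3$, $C_3e^k=e^1+\sum_{i=1}^{(k-1)/2}e^{2i}+e^k$; for even $k$ with $4\le k\le n-4$, $C_3e^k=\sum_{i=1}^{(k-2)/2}e^{2i+1}+e^k$; $C_3e^{n-2}=e^1+\sum_{i=1}^{(n-4)/2}e^{2i}+e^{n-2}$ and $C_3e^{n-1}=e^1+\sum_{i=1}^{(n-4)/2}e^{2i}+e^{n-1}$. For odd $n\ge 7$, $C_4$ is the $(n-1)\times(n-1)$ matrix with $C_4e^1=e^1$, $C_4e^2=e^2$; for odd $k$ with $3\le k\le n-2$, $C_4e^k=e^1+\sum_{i=1}^{(k-1)/2}e^{2i}+e^k$; for even $k$ with $4\le k\le n-3$, $C_4e^k=\sum_{i=1}^{(k-2)/2}e^{2i+1}+e^k$; and $C_4e^{n-1}=e^1+\sum_{i=1}^{(n-3)/2}e^{2i}+e^{n-1}$. All four matrices are upper triangular with entries in $\{0,1\}$ and ones on the diagonal, hence invertible. -}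

module Defs where

open import Data.Bool using (Bool; true; false; _∧_; _∨_; if_then_else_)
open import Data.Nat as ℕ using (ℕ; zero; suc; _∸_; _≡ᵇ_; _≤ᵇ_; _%_)
open import Data.Integer using (ℤ; +_)
open import Data.Fin using (Fin; zero; suc; toℕ; _<_)
open import Data.Rational using (ℚ; 0ℚ; 1ℚ; _+_; _*_; _-_; _/_)
open import Data.Product using (Σ; _×_)
open import Relation.Binary.PropositionalEquality using (_≡_)
open import Relation.Nullary using (¬_)

fib : ℕ → ℕ
fib 0 = 0
fib 1 = 1
fib (suc (suc m)) = fib (suc m) ℕ.+ fib m

-- Real (here: rational) matrices and vectors, indexed by Fin

Mat : ℕ → Set
Mat m = Fin m → Fin m → ℚ

Vect : ℕ → Set
Vect m = Fin m → ℚ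

Σℚ : ∀ {m} → (Fin m → ℚ) → ℚ
Σℚ {zero}  f = 0ℚ
Σℚ {suc m} f = f zero + Σℚ (λ i → f (suc i))

SV : ∀ {m} → Vect m → ℚ
SV v = Σℚ v

SM : ∀ {m} → Mat m → ℚ
SM X = Σℚ (λ i → Σℚ (λ j → X i j))

_⊗_ : ∀ {m} → Mat m → Mat m → Mat m
(A ⊗ B) i j = Σℚ (λ k → A i k * B k j)

idM : ∀ {m} → Mat m
idM i j = if toℕ i ≡ᵇ toℕ j then 1ℚ else 0ℚ

_≈M_ : ∀ {m} → Mat m → Mat m → Set
A ≈M B = ∀ i j → A i j ≡ B i j

UpperTriangular : ∀ {m} → Mat m → Set
UpperTriangular A = ∀ i j → j < i → A i j ≡ 0ℚ

ZeroOne : ∀ {m} → Mat m → Set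
ZeroOne A = ∀ i j → (A i j ≡ 0ℚ) Data.Sum.⊎ (A i j ≡ 1ℚ)
  where import Data.Sum

Invertible : ∀ {m} → Mat m → Set
Invertible {m} A = Σ (Mat m) (λ B → ((A ⊗ B) ≈M idM) × ((B ⊗ A) ≈M idM))

Singular : ∀ {m} → Mat m → Set
Singular A = ¬ Invertible A

IsGroupInverse : ∀ {m} → Mat m → Mat m → Set
IsGroupInverse A X = ((A ⊗ X) ⊗ A) ≈M A × ((X ⊗ A) ⊗ X) ≈M X × (A ⊗ X) ≈M (X ⊗ A)

-- C⁻¹ b for a unit upper triangular C (back substitution).
-- For C upper triangular with ones on the diagonal this is exactly
-- the vector C⁻¹ b (the diagonal of C is not read).

unitUpperSolve : ∀ {m} → Mat m → Vect m → Vect m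
unitUpperSolve {zero}  C b ()
unitUpperSolve {suc m} C b zero =
  b zero - Σℚ (λ j → C zero (suc j) * unitUpperSolve (λ i k → C (suc i) (suc k)) (λ i → b (suc i)) j)
unitUpperSolve {suc m} C b (suc i) =
  unitUpperSolve (λ i k → C (suc i) (suc k)) (λ i → b (suc i)) i

invSq : ∀ {m} → Mat m → Vect m → Vect m
invSq C b = unitUpperSolve C (unitUpperSolve C b)

-- The matrices C₁..C₄ and vectors uⁿ,vⁿ,wⁿ,zⁿ, described by 1-based
-- indices: entry (i,k) of C is 1 iff eⁱ occurs in C eᵏ.

isEven : ℕ → Bool
isEven i = i % 2 ≡ᵇ 0

isOdd : ℕ → Bool
isOdd i = i % 2 ≡ᵇ 1

btw : ℕ → ℕ → ℕ → Bool
btw a b i = (a ≤ᵇ i) ∧ (i ≤ᵇ b)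

colA : ℕ → ℕ → Bool
colA k i = (i ≡ᵇ 1) ∨ (isEven i ∧ btw 2 (k ∸ 1) i) ∨ (i ≡ᵇ k)

colB : ℕ → ℕ → Bool
colB k i = (isOdd i ∧ btw 3 (k ∸ 1) i) ∨ (i ≡ᵇ k)

oddRange : ℕ → ℕ → ℕ → Bool
oddRange a b i = isOdd i ∧ btw a b i

evenRange : ℕ → ℕ → ℕ → Bool
evenRange a b i = isEven i ∧ btw a b i

c1 : ℕ → ℕ → ℕ → Bool
c1 n i k =
  if k ≡ᵇ 1 then i ≡ᵇ 1 else
  if k ≡ᵇ 2 then i ≡ᵇ 2 else
  if isOdd k ∧ btw 3 (n ∸ 3) k then colA k i else
  if isEven k ∧ btw 4 (n ∸ 2) k then colB k i else
  if k ≡ᵇ n ∸ 1 then oddRange 3 (n ∸ 3) i ∨ (i ≡ᵇ n ∸ 1) else false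

c2 : ℕ → ℕ → ℕ → Bool
c2 n i k =
  if k ≡ᵇ 1 then i ≡ᵇ 1 else
  if k ≡ᵇ 2 then i ≡ᵇ 2 else
  if isOdd k ∧ btw 3 (n ∸ 4) k then colA k i else
  if isEven k ∧ btw 4 (n ∸ 3) k then colB k i else
  if k ≡ᵇ n ∸ 2 then oddRange 3 (n ∸ 4) i ∨ (i ≡ᵇ n ∸ 2) else
  if k ≡ᵇ n ∸ 1 then oddRange 3 (n ∸ 4) i ∨ (i ≡ᵇ n ∸ 1) else false

c3 : ℕ → ℕ → ℕ → Bool
c3 n i k =
  if k ≡ᵇ 1 then i ≡ᵇ 1 else
  if k ≡ᵇ 2 then i ≡ᵇ 2 else
  if isOdd k ∧ btw 3 (n ∸ 3) k then colA k i else
  if isEven k ∧ btw 4 (n ∸ 4) k then colB k i else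
  if k ≡ᵇ n ∸ 2 then (i ≡ᵇ 1) ∨ evenRange 2 (n ∸ 4) i ∨ (i ≡ᵇ n ∸ 2) else
  if k ≡ᵇ n ∸ 1 then (i ≡ᵇ 1) ∨ evenRange 2 (n ∸ 4) i ∨ (i ≡ᵇ n ∸ 1) else false

c4 : ℕ → ℕ → ℕ → Bool
c4 n i k =
  if k ≡ᵇ 1 then i ≡ᵇ 1 else
  if k ≡ᵇ 2 then i ≡ᵇ 2 else
  if isOdd k ∧ btw 3 (n ∸ 2) k then colA k i else
  if isEven k ∧ btw 4 (n ∸ 3) k then colB k i else
  if k ≡ᵇ n ∸ 1 then (i ≡ᵇ 1) ∨ evenRange 2 (n ∸ 3) i ∨ (i ≡ᵇ n ∸ 1) else false

b2q : Bool → ℚ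
b2q b = if b then 1ℚ else 0ℚ

mkMat : (n : ℕ) → (ℕ → ℕ → ℕ → Bool) → Mat (n ∸ 1)
mkMat n c i k = b2q (c n (suc (toℕ i)) (suc (toℕ k)))

mkVec : (n : ℕ) → (ℕ → ℕ → Bool) → Vect (n ∸ 1)
mkVec n v i = b2q (v n (suc (toℕ i)))

C₁ : (n : ℕ) → Mat (n ∸ 1)
C₁ n = mkMat n c1

C₂ : (n : ℕ) → Mat (n ∸ 1)
C₂ n = mkMat n c2

C₃ : (n : ℕ) → Mat (n ∸ 1)
C₃ n = mkMat n c3

C₄ : (n : ℕ) → Mat (n ∸ 1)
C₄ n = mkMat n c4


uvec : (n : ℕ) → Vect (n ∸ 1)
uvec n = mkVec n (λ n i → (i ≡ᵇ 1) ∨ evenRange 2 (n ∸ 2) i ∨ (i ≡ᵇ n ∸ 1))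
vvec : (n : ℕ) → Vect (n ∸ 1)
vvec n = mkVec n (λ n i → (i ≡ᵇ 1) ∨ evenRange 2 (n ∸ 3) i ∨ (i ≡ᵇ n ∸ 2) ∨ (i ≡ᵇ n ∸ 1))
wvec : (n : ℕ) → Vect (n ∸ 1)
wvec n = mkVec n (λ n i → oddRange 3 (n ∸ 3) i ∨ (i ≡ᵇ n ∸ 2) ∨ (i ≡ᵇ n ∸ 1))
zvec : (n : ℕ) → Vect (n ∸ 1)
zvec n = mkVec n (λ n i → oddRange 3 (n ∸ 2) i ∨ (i ≡ᵇ n ∸ 1))

pₙ : ℕ → ℚ
pₙ n = SV (invSq (C₁ n) (uvec n))
rₙ : ℕ → ℚ
rₙ n = SV (invSq (C₂ n) (vvec n))
qₙ : ℕ → ℚ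
qₙ n = Data.Rational.-_ (SV (invSq (C₃ n) (wvec n)))
sₙ : ℕ → ℚ
sₙ n = Data.Rational.-_ (SV (invSq (C₄ n) (zvec n)))

ℤ→ℚ : ℤ → ℚ
ℤ→ℚ z = z / 1

ℕ→ℚ : ℕ → ℚ
ℕ→ℚ m = (+ m) / 1

-- For a unit upper triangular 0/1 matrix C and a 0/1 vector u, the matrix A = [[C, u], [0, 0]] is
-- upper triangular, 0/1 and singular, with group inverse A# = [[C⁻¹, C⁻²u], [0, 0]]. Hence
-- S(A#) = S(C⁻¹) + S(C⁻²u) = S(h) + g·u, where hᵀC = 𝟙ᵀ and gᵀC = hᵀ.
--
-- In their leading columns C₁, …, C₄ follow one infinite unit upper triangular 0/1 pattern Γ, and
-- their last one or two columns repeat the column before above the diagonal. So h and g are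
-- truncations of two fixed integer sequences η = 𝟙ᵀΓ⁻¹ and γ = 𝟙ᵀΓ⁻², which alternate in sign and
-- grow like Fibonacci numbers, and S(h) = 2 ± F_{n-2}. Since ∣γ_{k+1}∣ ≤ 1 + Σ_{i≤k} ∣γ_i∣, the values
-- g·u over 0/1 vectors u fill the whole integer interval between the sum of the negative and the sum
-- of the positive entries of g. The interval around 2 + F_{n-2} obtained from C₁ (n even) or C₂
-- (n odd) and the one around 2 − F_{n-2} obtained from C₃ or C₄ are adjacent, and together they
-- contain the range of the hypothesis, whose endpoints are two particular values g·u.

module Submission where

open import Defs

module Matrices where

  open import Data.Nat as ℕ using (ℕ; zero; suc; s≤s; z≤n)
  import Data.Nat.Properties as ℕ
  open import Data.Fin as Fin using (Fin; zero; suc; fromℕ; inject₁)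
  import Data.Fin.Properties as Fin
  open import Data.Fin.Relation.Unary.Top using (View; view; ‵fromℕ; ‵inject₁; view-fromℕ; view-inject₁)
  open import Data.Rational using (ℚ; 0ℚ; 1ℚ; _+_; _*_; _-_; -_)
  import Data.Rational.Properties as ℚ
  open import Algebra.Bundles using (CommutativeRing)
  open import Algebra.Properties.Semiring.Sum (CommutativeRing.semiring ℚ.+-*-commutativeRing)
    using (sum; sum-cong-≗; sum-replicate-zero; ∑-distrib-+; ∑-comm; *-distribˡ-sum; *-distribʳ-sum; sum-init-last)
  open import Data.Product using (Σ; _×_; _,_)
  open import Data.Sum using (_⊎_; inj₁)
  open import Data.Empty using (⊥-elim)
  open import Function using (_∘_)
  open import Relation.Binary.PropositionalEquality

  private
    variable
      m : ℕ

  Σℚ≡sum : (f : Fin m → ℚ) → Σℚ f ≡ sum f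
  Σℚ≡sum {zero} f = refl
  Σℚ≡sum {suc m} f = cong (f zero +_) (Σℚ≡sum (f ∘ suc))

  Σℚ-cong : {f g : Fin m → ℚ} → f ≗ g → Σℚ f ≡ Σℚ g
  Σℚ-cong {f = f} {g} f≗g = trans (Σℚ≡sum f) (trans (sum-cong-≗ f≗g) (sym (Σℚ≡sum g)))

  Σℚ-zero : Σℚ {m} (λ _ → 0ℚ) ≡ 0ℚ
  Σℚ-zero {m} = trans (Σℚ≡sum {m} (λ _ → 0ℚ)) (sum-replicate-zero m)

  Σℚ-distrib-+ : (f g : Fin m → ℚ) → Σℚ (λ i → f i + g i) ≡ Σℚ f + Σℚ g
  Σℚ-distrib-+ f g = trans (Σℚ≡sum (λ i → f i + g i)) (trans (∑-distrib-+ f g) (sym (cong₂ _+_ (Σℚ≡sum f) (Σℚ≡sum g))))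

  *-distribˡ-Σℚ : (c : ℚ) (f : Fin m → ℚ) → c * Σℚ f ≡ Σℚ (λ i → c * f i)
  *-distribˡ-Σℚ c f = trans (cong (c *_) (Σℚ≡sum f)) (trans (*-distribˡ-sum c f) (sym (Σℚ≡sum (λ i → c * f i))))

  *-distribʳ-Σℚ : (c : ℚ) (f : Fin m → ℚ) → Σℚ f * c ≡ Σℚ (λ i → f i * c)
  *-distribʳ-Σℚ c f = trans (cong (_* c) (Σℚ≡sum f)) (trans (*-distribʳ-sum c f) (sym (Σℚ≡sum (λ i → f i * c))))

  Σℚ-comm : ∀ {k} (f : Fin m → Fin k → ℚ) → Σℚ (λ i → Σℚ (f i)) ≡ Σℚ (λ j → Σℚ (λ i → f i j))
  Σℚ-comm f = begin
    Σℚ (λ i → Σℚ (f i))             ≡⟨ Σℚ-cong (λ i → Σℚ≡sum (f i)) ⟩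
    Σℚ (λ i → sum (f i))            ≡⟨ Σℚ≡sum (λ i → sum (f i)) ⟩
    sum (λ i → sum (f i))           ≡⟨ ∑-comm f ⟩
    sum (λ j → sum (λ i → f i j))   ≡⟨ Σℚ≡sum (λ j → sum (λ i → f i j)) ⟨
    Σℚ (λ j → sum (λ i → f i j))    ≡⟨ Σℚ-cong (λ j → Σℚ≡sum (λ i → f i j)) ⟨
    Σℚ (λ j → Σℚ (λ i → f i j))     ∎
    where open ≡-Reasoning

  Σℚ-init-last : (f : Fin (suc m) → ℚ) → Σℚ f ≡ Σℚ (f ∘ inject₁) + f (fromℕ m)
  Σℚ-init-last f = trans (Σℚ≡sum f) (trans (sum-init-last f) (cong (_+ f (fromℕ _)) (sym (Σℚ≡sum (f ∘ inject₁)))))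

  infixr 7 _*ᵥ_
  infixl 7 _ᵥ*_
  infix 7 _∙_

  _*ᵥ_ : Mat m → Vect m → Vect m
  (C *ᵥ x) i = Σℚ (λ j → C i j * x j)

  _ᵥ*_ : Vect m → Mat m → Vect m
  (h ᵥ* C) j = Σℚ (λ i → h i * C i j)

  _∙_ : Vect m → Vect m → ℚ
  x ∙ y = Σℚ (λ i → x i * y i)

  ∙-basis : (f : Vect m) (j : Fin m) → f ∙ (λ k → idM k j) ≡ f j
  ∙-basis {suc m} f zero = begin
    f zero * 1ℚ + Σℚ (λ k → f (suc k) * 0ℚ)  ≡⟨ cong₂ _+_ (ℚ.*-identityʳ (f zero)) (trans (Σℚ-cong (λ k → ℚ.*-zeroʳ (f (suc k)))) (Σℚ-zero {m})) ⟩
    f zero + 0ℚ                              ≡⟨ ℚ.+-identityʳ (f zero) ⟩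
    f zero                                   ∎
    where open ≡-Reasoning
  ∙-basis f (suc j) = trans (cong₂ _+_ (ℚ.*-zeroʳ (f zero)) (∙-basis (f ∘ suc) j)) (ℚ.+-identityˡ (f (suc j)))

  *ᵥ-identityˡ : (x : Vect m) → idM *ᵥ x ≗ x
  *ᵥ-identityˡ x i = trans (Σℚ-cong (λ j → trans (ℚ.*-comm (idM i j) (x j)) (cong (x j *_) (idM-sym i j)))) (∙-basis x i)
    where
    idM-sym : ∀ {k} (i j : Fin k) → idM i j ≡ idM j i
    idM-sym zero    zero    = refl
    idM-sym zero    (suc j) = refl
    idM-sym (suc i) zero    = refl
    idM-sym (suc i) (suc j) = idM-sym i j

  *ᵥ-assoc : (A B : Mat m) (x : Vect m) → A *ᵥ B *ᵥ x ≗ (A ⊗ B) *ᵥ x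
  *ᵥ-assoc A B x i = begin
    Σℚ (λ j → A i j * Σℚ (λ k → B j k * x k))   ≡⟨ Σℚ-cong (λ j → trans (*-distribˡ-Σℚ (A i j) (λ k → B j k * x k)) (Σℚ-cong (λ k → sym (ℚ.*-assoc (A i j) (B j k) (x k))))) ⟩
    Σℚ (λ j → Σℚ (λ k → A i j * B j k * x k))   ≡⟨ Σℚ-comm (λ j k → A i j * B j k * x k) ⟩
    Σℚ (λ k → Σℚ (λ j → A i j * B j k * x k))   ≡⟨ Σℚ-cong (λ k → sym (*-distribʳ-Σℚ (x k) (λ j → A i j * B j k))) ⟩
    Σℚ (λ k → (A ⊗ B) i k * x k)                ∎
    where open ≡-Reasoning

  *ᵥ-congˡ : {A B : Mat m} (x : Vect m) → A ≈M B → A *ᵥ x ≗ B *ᵥ x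
  *ᵥ-congˡ x A≈B i = Σℚ-cong (λ j → cong (_* x j) (A≈B i j))

  ∙-transpose : (C : Mat m) (h : Vect m) {f : Vect m} (x : Vect m) → h ᵥ* C ≗ f → f ∙ x ≡ h ∙ (C *ᵥ x)
  ∙-transpose C h {f} x hC≗f = begin
    Σℚ (λ k → f k * x k)                         ≡⟨ Σℚ-cong (λ k → cong (_* x k) (sym (hC≗f k))) ⟩
    Σℚ (λ k → Σℚ (λ i → h i * C i k) * x k)      ≡⟨ Σℚ-cong (λ k → *-distribʳ-Σℚ (x k) (λ i → h i * C i k)) ⟩
    Σℚ (λ k → Σℚ (λ i → h i * C i k * x k))      ≡⟨ Σℚ-comm (λ k i → h i * C i k * x k) ⟩
    Σℚ (λ i → Σℚ (λ k → h i * C i k * x k))      ≡⟨ Σℚ-cong (λ i → trans (Σℚ-cong (λ k → ℚ.*-assoc (h i) (C i k) (x k))) (sym (*-distribˡ-Σℚ (h i) (λ k → C i k * x k)))) ⟩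
    Σℚ (λ i → h i * (C *ᵥ x) i)                  ∎
    where open ≡-Reasoning

  record UnitUpperTriangular (C : Mat m) : Set where
    field
      diagonal : ∀ i → C i i ≡ 1ℚ
      upper    : UpperTriangular C

  lowerRight : Mat (suc m) → Mat m
  lowerRight C i j = C (suc i) (suc j)

  lowerRight-unitUpperTriangular : {C : Mat (suc m)} → UnitUpperTriangular C → UnitUpperTriangular (lowerRight C)
  lowerRight-unitUpperTriangular uut = record
    { diagonal = λ i → diagonal (suc i)
    ; upper    = λ i j j<i → upper (suc i) (suc j) (s≤s j<i)
    }
    where open UnitUpperTriangular uut

  *ᵥ-suc : {C : Mat (suc m)} → UnitUpperTriangular C → (x : Vect (suc m)) (i : Fin m) →
           (C *ᵥ x) (suc i) ≡ (lowerRight C *ᵥ (x ∘ suc)) i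
  *ᵥ-suc {C = C} uut x i = begin
    C (suc i) zero * x zero + (lowerRight C *ᵥ (x ∘ suc)) i  ≡⟨ cong (λ c → c * x zero + (lowerRight C *ᵥ (x ∘ suc)) i) (upper (suc i) zero (s≤s z≤n)) ⟩
    0ℚ * x zero + (lowerRight C *ᵥ (x ∘ suc)) i               ≡⟨ cong (_+ (lowerRight C *ᵥ (x ∘ suc)) i) (ℚ.*-zeroˡ (x zero)) ⟩
    0ℚ + (lowerRight C *ᵥ (x ∘ suc)) i                        ≡⟨ ℚ.+-identityˡ _ ⟩
    (lowerRight C *ᵥ (x ∘ suc)) i                             ∎
    where
    open ≡-Reasoning
    open UnitUpperTriangular uut

  unitUpperSolve-correct : {C : Mat m} → UnitUpperTriangular C → (b : Vect m) → C *ᵥ unitUpperSolve C b ≗ b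
  unitUpperSolve-correct {suc m} {C} uut b zero = begin
    C zero zero * (b zero - S) + S  ≡⟨ cong (λ c → c * (b zero - S) + S) (diagonal zero) ⟩
    1ℚ * (b zero - S) + S           ≡⟨ cong (_+ S) (ℚ.*-identityˡ (b zero - S)) ⟩
    b zero - S + S                  ≡⟨ ℚ.+-assoc (b zero) (- S) S ⟩
    b zero + (- S + S)            ≡⟨ cong (b zero +_) (ℚ.+-inverseˡ S) ⟩
    b zero + 0ℚ                     ≡⟨ ℚ.+-identityʳ (b zero) ⟩
    b zero                          ∎
    where
    open ≡-Reasoning
    open UnitUpperTriangular uut
    S = Σℚ (λ j → C zero (suc j) * unitUpperSolve (lowerRight C) (b ∘ suc) j)
  unitUpperSolve-correct {C = C} uut b (suc i) =
    trans (*ᵥ-suc uut (unitUpperSolve C b) i) (unitUpperSolve-correct (lowerRight-unitUpperTriangular uut) (b ∘ suc) i)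

  unitUpperSolve-unique : {C : Mat m} → UnitUpperTriangular C → {x b : Vect m} → C *ᵥ x ≗ b → x ≗ unitUpperSolve C b
  unitUpperSolve-unique {suc m} {C} uut {x} {b} Cx≗b zero = begin
    x zero                          ≡⟨ +-cancelʳ (x zero) S ⟨
    x zero + S - S                  ≡⟨ cong (λ a → a + S - S) (ℚ.*-identityˡ (x zero)) ⟨
    1ℚ * x zero + S - S             ≡⟨ cong (λ c → c * x zero + S - S) (diagonal zero) ⟨
    C zero zero * x zero + S - S    ≡⟨ cong (_- S) (Cx≗b zero) ⟩
    b zero - S                      ≡⟨ cong (λ t → b zero - t) (Σℚ-cong (λ j → cong (C zero (suc j) *_) (tail-unique j))) ⟩
    unitUpperSolve C b zero         ∎
    where
    open ≡-Reasoning
    open UnitUpperTriangular uut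
    S = Σℚ (λ j → C zero (suc j) * x (suc j))
    +-cancelʳ : ∀ a s → a + s - s ≡ a
    +-cancelʳ a s = trans (ℚ.+-assoc a s (- s)) (trans (cong (a +_) (ℚ.+-inverseʳ s)) (ℚ.+-identityʳ a))
    tail-unique : x ∘ suc ≗ unitUpperSolve (lowerRight C) (b ∘ suc)
    tail-unique = unitUpperSolve-unique (lowerRight-unitUpperTriangular uut) (λ i → trans (sym (*ᵥ-suc uut x i)) (Cx≗b (suc i)))
  unitUpperSolve-unique {suc m} {C} uut {x} {b} Cx≗b (suc i) =
    unitUpperSolve-unique (lowerRight-unitUpperTriangular uut) (λ i → trans (sym (*ᵥ-suc uut x i)) (Cx≗b (suc i))) i

  inverse : Mat m → Mat m
  inverse C i j = unitUpperSolve C (λ k → idM k j) i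

  inverseʳ : {C : Mat m} → UnitUpperTriangular C → (C ⊗ inverse C) ≈M idM
  inverseʳ {C = C} uut i j = unitUpperSolve-correct uut (λ k → idM k j) i

  inverseˡ : {C : Mat m} → UnitUpperTriangular C → (inverse C ⊗ C) ≈M idM
  inverseˡ {C = C} uut i j = trans (unitUpperSolve-unique uut column-of-product i) (sym (unitUpperSolve-unique uut column-of-identity i))
    where
    column : Vect _
    column k = C k j
    column-of-product : C *ᵥ (λ k → (inverse C ⊗ C) k j) ≗ column
    column-of-product k = trans (*ᵥ-assoc C (inverse C) column k) (trans (*ᵥ-congˡ column (inverseʳ uut) k) (*ᵥ-identityˡ column k))
    column-of-identity : C *ᵥ (λ k → idM k j) ≗ column
    column-of-identity k = ∙-basis (C k) j

  borderedEntry : Mat m → Vect m → {i j : Fin (suc m)} → View i → View j → ℚ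
  borderedEntry C u (‵inject₁ a) (‵inject₁ b) = C a b
  borderedEntry C u (‵inject₁ a) ‵fromℕ       = u a
  borderedEntry C u ‵fromℕ       _            = 0ℚ

  bordered : Mat m → Vect m → Mat (suc m)
  bordered C u i j = borderedEntry C u (view i) (view j)

  module _ (C : Mat m) (u : Vect m) where

    bordered-inner : ∀ a b → bordered C u (inject₁ a) (inject₁ b) ≡ C a b
    bordered-inner a b rewrite view-inject₁ a | view-inject₁ b = refl

    bordered-column : ∀ a → bordered C u (inject₁ a) (fromℕ m) ≡ u a
    bordered-column a rewrite view-inject₁ a | view-fromℕ m = refl

    bordered-lastRow : ∀ j → bordered C u (fromℕ m) j ≡ 0ℚ
    bordered-lastRow j rewrite view-fromℕ m = refl

  bordered-cong : {C C′ : Mat m} {u u′ : Vect m} → C ≈M C′ → u ≗ u′ → bordered C u ≈M bordered C′ u′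
  bordered-cong C≈C′ u≗u′ i j = entry (view i) (view j)
    where
    entry : ∀ {i j} (vi : View i) (vj : View j) → borderedEntry _ _ vi vj ≡ borderedEntry _ _ vi vj
    entry (‵inject₁ a) (‵inject₁ b) = C≈C′ a b
    entry (‵inject₁ a) ‵fromℕ       = u≗u′ a
    entry ‵fromℕ       _            = refl

  lastRow-zero-⊗ : (A B : Mat (suc m)) → (∀ j → A (fromℕ m) j ≡ 0ℚ) → ∀ j → (A ⊗ B) (fromℕ m) j ≡ 0ℚ
  lastRow-zero-⊗ {m} A B A₀ j = trans (Σℚ-cong (λ k → trans (cong (_* B k j) (A₀ k)) (ℚ.*-zeroˡ (B k j)))) (Σℚ-zero {suc m})

  bordered-⊗ : (C E : Mat m) (u w : Vect m) → (bordered C u ⊗ bordered E w) ≈M bordered (C ⊗ E) (C *ᵥ w)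
  bordered-⊗ {m} C E u w i j = entry (view i) (view j)
    where
    A = bordered C u
    X = bordered E w
    inner-sum : ∀ a (j : Fin (suc m)) → (A ⊗ X) (inject₁ a) j ≡ Σℚ (λ k → C a k * X (inject₁ k) j)
    inner-sum a j = begin
      (A ⊗ X) (inject₁ a) j                                                       ≡⟨ Σℚ-init-last (λ k → A (inject₁ a) k * X k j) ⟩
      Σℚ (λ k → A (inject₁ a) (inject₁ k) * X (inject₁ k) j) + A (inject₁ a) (fromℕ m) * X (fromℕ m) j
          ≡⟨ cong₂ _+_ (Σℚ-cong (λ k → cong (_* X (inject₁ k) j) (bordered-inner C u a k)))
                       (trans (cong (A (inject₁ a) (fromℕ m) *_) (bordered-lastRow E w j)) (ℚ.*-zeroʳ (A (inject₁ a) (fromℕ m)))) ⟩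
      Σℚ (λ k → C a k * X (inject₁ k) j) + 0ℚ                                     ≡⟨ ℚ.+-identityʳ _ ⟩
      Σℚ (λ k → C a k * X (inject₁ k) j)                                          ∎
      where open ≡-Reasoning
    entry : ∀ {i j} (vi : View i) (vj : View j) → (A ⊗ X) i j ≡ bordered (C ⊗ E) (C *ᵥ w) i j
    entry (‵inject₁ a) (‵inject₁ b) = trans (inner-sum a (inject₁ b))
      (trans (Σℚ-cong (λ k → cong (C a k *_) (bordered-inner E w k b))) (sym (bordered-inner (C ⊗ E) (C *ᵥ w) a b)))
    entry (‵inject₁ a) ‵fromℕ = trans (inner-sum a (fromℕ m))
      (trans (Σℚ-cong (λ k → cong (C a k *_) (bordered-column E w k))) (sym (bordered-column (C ⊗ E) (C *ᵥ w) a)))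
    entry {j = j} ‵fromℕ _ = trans (lastRow-zero-⊗ A X (bordered-lastRow C u) j) (sym (bordered-lastRow (C ⊗ E) (C *ᵥ w) j))

  ≈M-trans : {A B E : Mat m} → A ≈M B → B ≈M E → A ≈M E
  ≈M-trans A≈B B≈E i j = trans (A≈B i j) (B≈E i j)

  ≈M-sym : {A B : Mat m} → A ≈M B → B ≈M A
  ≈M-sym A≈B i j = sym (A≈B i j)

  ⊗-congˡ : {A A′ : Mat m} (B : Mat m) → A ≈M A′ → (A ⊗ B) ≈M (A′ ⊗ B)
  ⊗-congˡ B A≈A′ i j = Σℚ-cong (λ k → cong (_* B k j) (A≈A′ i k))

  ⊗-identityˡ : (C : Mat m) → (idM ⊗ C) ≈M C
  ⊗-identityˡ C i j = *ᵥ-identityˡ (λ k → C k j) i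

  module _ {C : Mat m} (uut : UnitUpperTriangular C) (u : Vect m) where
    private
      x = unitUpperSolve C u
      P = bordered idM x

      inverse*ᵥu : inverse C *ᵥ u ≗ x
      inverse*ᵥu = unitUpperSolve-unique uut (λ i →
        trans (*ᵥ-assoc C (inverse C) u i) (trans (*ᵥ-congˡ u (inverseʳ uut) i) (*ᵥ-identityˡ u i)))

      A⊗X : (bordered C u ⊗ bordered (inverse C) (invSq C u)) ≈M P
      A⊗X = ≈M-trans (bordered-⊗ C (inverse C) u (invSq C u)) (bordered-cong (inverseʳ uut) (unitUpperSolve-correct uut x))

      X⊗A : (bordered (inverse C) (invSq C u) ⊗ bordered C u) ≈M P
      X⊗A = ≈M-trans (bordered-⊗ (inverse C) C (invSq C u) u) (bordered-cong (inverseˡ uut) inverse*ᵥu)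

      P⊗ : (E : Mat m) (w : Vect m) → (P ⊗ bordered E w) ≈M bordered E w
      P⊗ E w = ≈M-trans (bordered-⊗ idM E x w) (bordered-cong (⊗-identityˡ E) (*ᵥ-identityˡ w))

    bordered-groupInverse : IsGroupInverse (bordered C u) (bordered (inverse C) (invSq C u))
    bordered-groupInverse =
      ≈M-trans (⊗-congˡ (bordered C u) A⊗X) (P⊗ C u) ,
      ≈M-trans (⊗-congˡ (bordered (inverse C) (invSq C u)) X⊗A) (P⊗ (inverse C) (invSq C u)) ,
      ≈M-trans A⊗X (≈M-sym X⊗A)

  SM-bordered : (C : Mat m) (u : Vect m) → SM (bordered C u) ≡ SM C + SV u
  SM-bordered {m} C u = begin
    SM (bordered C u)
      ≡⟨ Σℚ-init-last (λ i → Σℚ (bordered C u i)) ⟩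
    Σℚ (λ a → Σℚ (bordered C u (inject₁ a))) + Σℚ (bordered C u (fromℕ m))
      ≡⟨ cong₂ _+_ (Σℚ-cong row) (trans (Σℚ-cong (bordered-lastRow C u)) (Σℚ-zero {suc m})) ⟩
    Σℚ (λ a → Σℚ (C a) + u a) + 0ℚ
      ≡⟨ ℚ.+-identityʳ _ ⟩
    Σℚ (λ a → Σℚ (C a) + u a)
      ≡⟨ Σℚ-distrib-+ (λ a → Σℚ (C a)) u ⟩
    SM C + SV u
      ∎
    where
    open ≡-Reasoning
    row : ∀ a → Σℚ (bordered C u (inject₁ a)) ≡ Σℚ (C a) + u a
    row a = trans (Σℚ-init-last (bordered C u (inject₁ a)))
                  (cong₂ _+_ (Σℚ-cong (bordered-inner C u a)) (bordered-column C u a))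

  idM-diagonal : (i : Fin m) → idM i i ≡ 1ℚ
  idM-diagonal zero    = refl
  idM-diagonal (suc i) = idM-diagonal i

  bordered-singular : (C : Mat m) (u : Vect m) → Singular (bordered C u)
  bordered-singular {m} C u (B , A⊗B≈I , _) with
    trans (sym (idM-diagonal (fromℕ m))) (trans (sym (A⊗B≈I (fromℕ m) (fromℕ m))) (lastRow-zero-⊗ (bordered C u) B (bordered-lastRow C u) (fromℕ m)))
  ... | ()

  bordered-zeroOne : {C : Mat m} {u : Vect m} → ZeroOne C → (∀ i → u i ≡ 0ℚ ⊎ u i ≡ 1ℚ) → ZeroOne (bordered C u)
  bordered-zeroOne {C = C} {u} C01 u01 i j = entry (view i) (view j)
    where
    entry : ∀ {i j} (vi : View i) (vj : View j) → borderedEntry C u vi vj ≡ 0ℚ ⊎ borderedEntry C u vi vj ≡ 1ℚ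
    entry (‵inject₁ a) (‵inject₁ b) = C01 a b
    entry (‵inject₁ a) ‵fromℕ       = u01 a
    entry ‵fromℕ       _            = inj₁ refl

  bordered-upperTriangular : {C : Mat m} (u : Vect m) → UpperTriangular C → UpperTriangular (bordered C u)
  bordered-upperTriangular {m} {C} u upper i j = entry (view i) (view j)
    where
    entry : ∀ {i j} → View i → View j → j Fin.< i → bordered C u i j ≡ 0ℚ
    entry (‵inject₁ a) (‵inject₁ b) b<a = trans (bordered-inner C u a b)
      (upper a b (subst₂ ℕ._<_ (Fin.toℕ-inject₁ b) (Fin.toℕ-inject₁ a) b<a))
    entry (‵inject₁ a) ‵fromℕ m<a = ⊥-elim (ℕ.<-asym (subst₂ ℕ._<_ (Fin.toℕ-fromℕ m) (Fin.toℕ-inject₁ a) m<a) (Fin.toℕ<n a))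
    entry {j = j} ‵fromℕ _ _ = bordered-lastRow C u j

  ones : Vect m
  ones _ = 1ℚ

  SV≡ones∙ : (x : Vect m) → SV x ≡ ones ∙ x
  SV≡ones∙ x = Σℚ-cong (λ i → sym (ℚ.*-identityˡ (x i)))

  ∙-unitUpperSolve : {C : Mat m} → UnitUpperTriangular C → (h : Vect m) {f : Vect m} → h ᵥ* C ≗ f →
                     (b : Vect m) → f ∙ unitUpperSolve C b ≡ h ∙ b
  ∙-unitUpperSolve {C = C} uut h hC≗f b =
    trans (∙-transpose C h (unitUpperSolve C b) hC≗f) (Σℚ-cong (λ i → cong (h i *_) (unitUpperSolve-correct uut b i)))

  SV-invSq : {C : Mat m} → UnitUpperTriangular C → (h g : Vect m) → h ᵥ* C ≗ ones → g ᵥ* C ≗ h →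
             (b : Vect m) → SV (invSq C b) ≡ g ∙ b
  SV-invSq {C = C} uut h g hC≗1 gC≗h b = begin
    SV (invSq C b)              ≡⟨ SV≡ones∙ (invSq C b) ⟩
    ones ∙ invSq C b            ≡⟨ ∙-unitUpperSolve uut h hC≗1 (unitUpperSolve C b) ⟩
    h ∙ unitUpperSolve C b      ≡⟨ ∙-unitUpperSolve uut g gC≗h b ⟩
    g ∙ b                       ∎
    where open ≡-Reasoning

  SM-inverse : {C : Mat m} → UnitUpperTriangular C → (h : Vect m) → h ᵥ* C ≗ ones → SM (inverse C) ≡ SV h
  SM-inverse {C = C} uut h hC≗1 = trans (Σℚ-comm (inverse C)) (Σℚ-cong column)
    where
    column : ∀ j → Σℚ (λ i → inverse C i j) ≡ h j
    column j = begin
      Σℚ (λ i → inverse C i j)                  ≡⟨ SV≡ones∙ (λ i → inverse C i j) ⟩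
      ones ∙ unitUpperSolve C (λ k → idM k j)   ≡⟨ ∙-unitUpperSolve uut h hC≗1 (λ k → idM k j) ⟩
      h ∙ (λ k → idM k j)                       ≡⟨ ∙-basis h j ⟩
      h j                                       ∎
      where open ≡-Reasoning

  Realisable : ℕ → ℚ → Set
  Realisable n v = Σ (Mat n) (λ A → ZeroOne A × UpperTriangular A × Singular A ×
                     Σ (Mat n) (λ X → IsGroupInverse A X × SM X ≡ v))

  bordered-realisable : {C : Mat m} → UnitUpperTriangular C → ZeroOne C → (h g : Vect m) →
                        h ᵥ* C ≗ ones → g ᵥ* C ≗ h → {u : Vect m} → (∀ i → u i ≡ 0ℚ ⊎ u i ≡ 1ℚ) →
                        Realisable (suc m) (SV h + g ∙ u)
  bordered-realisable {C = C} uut C01 h g hC≗1 gC≗h {u} u01 =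
    bordered C u , bordered-zeroOne C01 u01 , bordered-upperTriangular u (UnitUpperTriangular.upper uut) , bordered-singular C u ,
    bordered (inverse C) (invSq C u) , bordered-groupInverse uut u ,
    trans (SM-bordered (inverse C) (invSq C u)) (cong₂ _+_ (SM-inverse uut h hC≗1) (SV-invSq uut h g hC≗1 gC≗h u))


module StandardPattern where

  open import Data.Bool using (Bool; true; false; _∧_; _∨_; if_then_else_; T)
  open import Data.Bool.Properties using (∧-zeroʳ; ∨-zeroʳ)
  open import Data.Nat using (ℕ; suc; _+_; _≤_; _<_; _≤ᵇ_; _≡ᵇ_; z≤n; s≤s)
  import Data.Nat.Properties as ℕ
  open import Data.Product using (_×_; _,_)
  open import Data.Sum using (_⊎_; inj₁; inj₂)
  open import Relation.Binary.PropositionalEquality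
  open import Relation.Nullary using (¬_; contradiction; yes; no)
  open import Function using (_∘_)

  private
    variable
      a b : Bool
      i j k : ℕ
      A : Set

  if-true : b ≡ true → {x y : A} → (if b then x else y) ≡ x
  if-true refl = refl

  if-false : b ≡ false → {x y : A} → (if b then x else y) ≡ y
  if-false refl = refl

  ∨≡false : a ≡ false → b ≡ false → a ∨ b ≡ false
  ∨≡false refl refl = refl

  ∨≡trueˡ : a ≡ true → ∀ b → a ∨ b ≡ true
  ∨≡trueˡ refl _ = refl

  ∨≡trueʳ : ∀ a → b ≡ true → a ∨ b ≡ true
  ∨≡trueʳ a refl = ∨-zeroʳ a

  ∧≡falseˡ : a ≡ false → ∀ b → a ∧ b ≡ false
  ∧≡falseˡ refl _ = refl

  ∧≡falseʳ : ∀ a → b ≡ false → a ∧ b ≡ false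
  ∧≡falseʳ a refl = ∧-zeroʳ a

  ∧≡true : a ≡ true → b ≡ true → a ∧ b ≡ true
  ∧≡true refl refl = refl

  T⇒≡true : T b → b ≡ true
  T⇒≡true {true} _ = refl

  ¬T⇒≡false : ¬ T b → b ≡ false
  ¬T⇒≡false {true}  ¬t = contradiction _ ¬t
  ¬T⇒≡false {false} _  = refl

  ≡ᵇ-refl : ∀ k → (k ≡ᵇ k) ≡ true
  ≡ᵇ-refl k = T⇒≡true (ℕ.≡⇒≡ᵇ k k refl)

  ≡ᵇ-false : i ≢ j → (i ≡ᵇ j) ≡ false
  ≡ᵇ-false {i} {j} i≢j = ¬T⇒≡false (i≢j ∘ ℕ.≡ᵇ⇒≡ i j)

  ≡ᵇ-cancelʳ : ∀ q i j → ((i + q) ≡ᵇ (j + q)) ≡ (i ≡ᵇ j)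
  ≡ᵇ-cancelʳ q i j with i ℕ.≟ j
  ... | yes refl = trans (≡ᵇ-refl (i + q)) (sym (≡ᵇ-refl i))
  ... | no  i≢j  = trans (≡ᵇ-false (i≢j ∘ ℕ.+-cancelʳ-≡ q i j)) (sym (≡ᵇ-false i≢j))

  <⇒≡ᵇ-false : i < j → (i ≡ᵇ j) ≡ false
  <⇒≡ᵇ-false i<j = ≡ᵇ-false (ℕ.<⇒≢ i<j)

  >⇒≡ᵇ-false : j < i → (i ≡ᵇ j) ≡ false
  >⇒≡ᵇ-false j<i = ≡ᵇ-false (ℕ.>⇒≢ j<i)

  ≤⇒≤ᵇ-true : i ≤ j → (i ≤ᵇ j) ≡ true
  ≤⇒≤ᵇ-true i≤j = T⇒≡true (ℕ.≤⇒≤ᵇ i≤j)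

  >⇒≤ᵇ-false : j < i → (i ≤ᵇ j) ≡ false
  >⇒≤ᵇ-false {j} {i} j<i = ¬T⇒≡false (ℕ.<⇒≱ j<i ∘ ℕ.≤ᵇ⇒≤ i j)

  Parity : ℕ → Set
  Parity k = (isOdd k ≡ true × isEven k ≡ false) ⊎ (isOdd k ≡ false × isEven k ≡ true)

  parity : ∀ k → Parity k
  parity 0 = inj₂ (refl , refl)
  parity 1 = inj₁ (refl , refl)
  parity (suc (suc k)) = parity k

  isOdd-suc : ∀ k → isOdd (suc k) ≡ isEven k
  isOdd-suc 0 = refl
  isOdd-suc 1 = refl
  isOdd-suc (suc (suc k)) = isOdd-suc k

  isEven-suc : ∀ k → isEven (suc k) ≡ isOdd k
  isEven-suc 0 = refl
  isEven-suc 1 = refl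
  isEven-suc (suc (suc k)) = isEven-suc k

  -- Column k of Γ; as in Defs, rows and columns are numbered from 1.
  standard : ℕ → ℕ → Bool
  standard 0 i = false
  standard 1 i = i ≡ᵇ 1
  standard 2 i = i ≡ᵇ 2
  standard k@(suc (suc (suc _))) i = if isOdd k then colA k i else colB k i

  standard-below : 1 ≤ k → k < i → standard k i ≡ false
  standard-below {1} _ k<i = >⇒≡ᵇ-false k<i
  standard-below {2} _ k<i = >⇒≡ᵇ-false k<i
  standard-below {k@(suc (suc (suc k′)))} {i} _ k<i with parity k
  ... | inj₁ (odd , _) = trans (if-true odd)
        (∨≡false (>⇒≡ᵇ-false (ℕ.<-trans (s≤s (s≤s z≤n)) (ℕ.<-trans (s≤s (s≤s (s≤s z≤n))) k<i)))
          (∨≡false (∧≡falseʳ (isEven i) (∧≡falseʳ (2 ≤ᵇ i) (>⇒≤ᵇ-false (ℕ.<-trans (ℕ.n<1+n _) k<i)))) (>⇒≡ᵇ-false k<i)))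
  ... | inj₂ (not-odd , _) = trans (if-false not-odd)
        (∨≡false (∧≡falseʳ (isOdd i) (∧≡falseʳ (3 ≤ᵇ i) (>⇒≤ᵇ-false (ℕ.<-trans (ℕ.n<1+n _) k<i)))) (>⇒≡ᵇ-false k<i))

  standard-diagonal : 1 ≤ k → standard k k ≡ true
  standard-diagonal {1} _ = refl
  standard-diagonal {2} _ = refl
  standard-diagonal {k@(suc (suc (suc k′)))} _ with parity k
  ... | inj₁ (odd , _)  = trans (if-true odd) (∨≡trueʳ (isEven k ∧ (k ≤ᵇ 2 + k′)) (≡ᵇ-refl k′))
  ... | inj₂ (not-odd , _) = trans (if-false not-odd) (∨≡trueʳ (isOdd k ∧ (k ≤ᵇ 2 + k′)) (≡ᵇ-refl k′))

  private
    ≤ᵇ-step : i ≤ k → (i ≤ᵇ 2 + k) ≡ (i ≤ᵇ k)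
    ≤ᵇ-step i≤k = trans (≤⇒≤ᵇ-true (ℕ.≤-trans i≤k (ℕ.m≤n+m _ 2))) (sym (≤⇒≤ᵇ-true i≤k))

    ≡ᵇ-step : i < k → (i ≡ᵇ 2 + k) ≡ (i ≡ᵇ k)
    ≡ᵇ-step i<k = trans (<⇒≡ᵇ-false (ℕ.<-≤-trans i<k (ℕ.m≤n+m _ 2))) (sym (<⇒≡ᵇ-false i<k))

  standard-step : 2 ≤ k → i < k → standard (2 + k) i ≡ standard k i
  standard-step {2} {0} _ _ = refl
  standard-step {2} {1} _ _ = refl
  standard-step {2} {suc (suc _)} _ (s≤s (s≤s ()))
  standard-step {1} (s≤s ()) _
  standard-step {k@(suc (suc (suc k′)))} {i} _ i<k with parity k
  ... | inj₁ (odd , _) = trans (if-true odd)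
        (trans (cong₂ (λ x y → (i ≡ᵇ 1) ∨ (isEven i ∧ ((2 ≤ᵇ i) ∧ x)) ∨ y) (≤ᵇ-step (ℕ.≤-pred i<k)) (≡ᵇ-step i<k)) (sym (if-true odd)))
  ... | inj₂ (not-odd , _) = trans (if-false not-odd)
        (trans (cong₂ (λ x y → (isOdd i ∧ ((3 ≤ᵇ i) ∧ x)) ∨ y) (≤ᵇ-step (ℕ.≤-pred i<k)) (≡ᵇ-step i<k)) (sym (if-false not-odd)))

  standard-step-superdiagonal : 2 ≤ k → standard (2 + k) (1 + k) ≡ true
  standard-step-superdiagonal {2} _ = refl
  standard-step-superdiagonal {1} (s≤s ())
  standard-step-superdiagonal {k@(suc (suc (suc k′)))} _ with parity k
  ... | inj₁ (odd , _) = trans (if-true odd)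
        (∨≡trueˡ (∧≡true (trans (isEven-suc k) odd) (≤⇒≤ᵇ-true (ℕ.≤-refl {4 + k′}))) (4 + k′ ≡ᵇ 5 + k′))
  ... | inj₂ (not-odd , even) = trans (if-false not-odd)
        (∨≡trueˡ (∧≡true (trans (isOdd-suc k) even) (≤⇒≤ᵇ-true (ℕ.≤-refl {4 + k′}))) (4 + k′ ≡ᵇ 5 + k′))

  standard-step-diagonal : 2 ≤ k → standard (2 + k) k ≡ false
  standard-step-diagonal {2} _ = refl
  standard-step-diagonal {1} (s≤s ())
  standard-step-diagonal {k@(suc (suc (suc k′)))} _ with parity k
  ... | inj₁ (odd , not-even) = trans (if-true odd)
        (∨≡false (∧≡falseˡ not-even (k ≤ᵇ 4 + k′)) (<⇒≡ᵇ-false (ℕ.<-trans (ℕ.n<1+n k) (ℕ.n<1+n _))))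
  ... | inj₂ (not-odd , _) = trans (if-false not-odd)
        (∨≡false (∧≡falseˡ not-odd (k ≤ᵇ 4 + k′)) (<⇒≡ᵇ-false (ℕ.<-trans (ℕ.n<1+n k) (ℕ.n<1+n _))))


module IntegerSums where

  open import Data.Bool using (Bool; true; false)
  open import Data.Nat as ℕ using (ℕ; zero; suc; _≤_; _<_; _⊓_; z≤n; s≤s)
  import Data.Nat.Properties as ℕ
  open import Data.Integer as ℤ using (ℤ; +_; 0ℤ; 1ℤ; _+_; _*_)
  import Data.Integer.Properties as ℤ
  open import Data.Integer.Tactic.RingSolver using (solve-∀)
  open import Data.Sum using (inj₁; inj₂)
  open import Relation.Binary.PropositionalEquality

  private
    variable
      k : ℕ

  ∑ : ℕ → (ℕ → ℤ) → ℤ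
  ∑ zero    f = 0ℤ
  ∑ (suc k) f = ∑ k f + f (suc k)

  ∑-cong : ∀ k {f g : ℕ → ℤ} → (∀ {i} → 1 ≤ i → i ≤ k → f i ≡ g i) → ∑ k f ≡ ∑ k g
  ∑-cong zero    f≗g = refl
  ∑-cong (suc k) f≗g = cong₂ _+_ (∑-cong k (λ 1≤i i≤k → f≗g 1≤i (ℕ.m≤n⇒m≤1+n i≤k))) (f≗g (s≤s z≤n) ℕ.≤-refl)

  ∑-split : ∀ r q (f : ℕ → ℤ) → ∑ (r ℕ.+ q) f ≡ ∑ q f + ∑ r (λ j → f (j ℕ.+ q))
  ∑-split zero    q f = sym (ℤ.+-identityʳ (∑ q f))
  ∑-split (suc r) q f = trans (cong (_+ f (suc r ℕ.+ q)) (∑-split r q f)) (ℤ.+-assoc (∑ q f) _ _)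

  ∑-vanishing : ∀ {k n} (f : ℕ → ℤ) → k ≤ n → (∀ {i} → k < i → i ≤ n → f i ≡ 0ℤ) → ∑ n f ≡ ∑ k f
  ∑-vanishing {k} {zero}  f z≤n _ = refl
  ∑-vanishing {k} {suc n} f k≤n f≡0 with ℕ.m≤n⇒m<n∨m≡n k≤n
  ... | inj₂ refl = refl
  ... | inj₁ k<n  = trans (cong₂ _+_ (∑-vanishing f (ℕ.≤-pred k<n) (λ k<i i≤n → f≡0 k<i (ℕ.m≤n⇒m≤1+n i≤n))) (f≡0 k<n ℕ.≤-refl))
                          (ℤ.+-identityʳ (∑ k f))

  ∑-zero : ∀ n {f : ℕ → ℤ} → (∀ {i} → 1 ≤ i → i ≤ n → f i ≡ 0ℤ) → ∑ n f ≡ 0ℤ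
  ∑-zero zero    _   = refl
  ∑-zero (suc n) f≡0 = cong₂ _+_ (∑-zero n (λ 1≤i i≤n → f≡0 1≤i (ℕ.m≤n⇒m≤1+n i≤n))) (f≡0 (s≤s z≤n) ℕ.≤-refl)

  ∑-single : ∀ n (f : ℕ → ℤ) → 1 ≤ k → k ≤ n → (∀ {i} → 1 ≤ i → i ≤ n → i ≢ k → f i ≡ 0ℤ) → ∑ n f ≡ f k
  ∑-single {suc k} n f _ k≤n f≡0 = begin
    ∑ n f             ≡⟨ ∑-vanishing f k≤n (λ k<i i≤n → f≡0 (ℕ.≤-trans (s≤s z≤n) k<i) i≤n (ℕ.>⇒≢ k<i)) ⟩
    ∑ k f + f (suc k) ≡⟨ cong (_+ f (suc k)) (∑-zero k (λ 1≤i i≤k → f≡0 1≤i (ℕ.≤-trans (ℕ.m≤n⇒m≤1+n i≤k) k≤n) (ℕ.<⇒≢ (s≤s i≤k)))) ⟩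
    0ℤ + f (suc k)    ≡⟨ ℤ.+-identityˡ (f (suc k)) ⟩
    f (suc k)         ∎
    where open ≡-Reasoning

  ∑-monotone : ∀ {q M} (f : ℕ → ℤ) → (∀ i → 0ℤ ℤ.≤ f i) → q ≤ M → ∑ q f ℤ.≤ ∑ M f
  ∑-monotone {q} {M} f 0≤f q≤M with ℕ.m≤n⇒m<n∨m≡n q≤M
  ... | inj₂ refl = ℤ.≤-refl
  ∑-monotone {q} {suc M} f 0≤f q≤M | inj₁ q<1+M =
    ℤ.≤-trans (∑-monotone f 0≤f (ℕ.≤-pred q<1+M)) (ℤ.i≤i+j (∑ M f) (f (suc M)) {{ℤ.nonNegative (0≤f (suc M))}})

  ∑-antitone : ∀ {q M} (f : ℕ → ℤ) → (∀ i → f i ℤ.≤ 0ℤ) → q ≤ M → ∑ M f ℤ.≤ ∑ q f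
  ∑-antitone {q} {M} f f≤0 q≤M with ℕ.m≤n⇒m<n∨m≡n q≤M
  ... | inj₂ refl = ℤ.≤-refl
  ∑-antitone {q} {suc M} f f≤0 q≤M | inj₁ q<1+M =
    ℤ.≤-trans (ℤ.≤-trans (ℤ.+-monoʳ-≤ (∑ M f) (f≤0 (suc M))) (ℤ.≤-reflexive (ℤ.+-identityʳ (∑ M f)))) (∑-antitone f f≤0 (ℕ.≤-pred q<1+M))

  χ : Bool → ℤ
  χ true  = 1ℤ
  χ false = 0ℤ

  ∑-const : ∀ r (x : ℤ) → ∑ r (λ _ → x) ≡ + r * x
  ∑-const zero    x = sym (ℤ.*-zeroˡ x)
  ∑-const (suc r) x = begin
    ∑ r (λ _ → x) + x    ≡⟨ cong (_+ x) (∑-const r x) ⟩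
    + r * x + x          ≡⟨ ℤ.+-comm (+ r * x) x ⟩
    x + + r * x          ≡⟨ ℤ.suc-* (+ r) x ⟨
    + suc r * x          ∎
    where open ≡-Reasoning

  truncate : ℕ → (ℕ → ℤ) → ℕ → ℤ
  truncate q F i = F (i ⊓ q)

  ∑-truncated : ∀ r q (F : ℕ → ℤ) → ∑ (r ℕ.+ q) (truncate q F) ≡ ∑ q F + + r * F q
  ∑-truncated r q F = begin
    ∑ (r ℕ.+ q) (truncate q F)                             ≡⟨ ∑-split r q (truncate q F) ⟩
    ∑ q (truncate q F) + ∑ r (λ j → F ((j ℕ.+ q) ⊓ q))     ≡⟨ cong₂ _+_ (∑-cong q (λ _ i≤q → cong F (ℕ.m≤n⇒m⊓n≡m i≤q)))
                                                                       (∑-cong r (λ {j} _ _ → cong F (ℕ.m≥n⇒m⊓n≡n (ℕ.m≤n+m q j)))) ⟩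
    ∑ q F + ∑ r (λ _ → F q)                                ≡⟨ cong (λ y → ∑ q F + y) (∑-const r (F q)) ⟩
    ∑ q F + + r * F q                                      ∎
    where open ≡-Reasoning

  ∑-truncated-1 : ∀ q F → ∑ (1 ℕ.+ q) (truncate q F) ≡ ∑ q F + F q
  ∑-truncated-1 q F = trans (∑-truncated 1 q F) (cong (λ x → ∑ q F + x) (ℤ.*-identityˡ (F q)))

  ∑-truncated-2 : ∀ q F → ∑ (2 ℕ.+ q) (truncate q F) ≡ ∑ q F + F q + F q
  ∑-truncated-2 q F = trans (∑-truncated 2 q F) (twice (∑ q F) (F q))
    where
    twice : ∀ a x → a + + 2 * x ≡ a + x + x
    twice = solve-∀

  ∑ℕ : ℕ → (ℕ → ℕ) → ℕ
  ∑ℕ zero    f = 0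
  ∑ℕ (suc k) f = ∑ℕ k f ℕ.+ f (suc k)

  ∑ℕ-cong : ∀ k {f g : ℕ → ℕ} → (∀ {i} → 1 ≤ i → i ≤ k → f i ≡ g i) → ∑ℕ k f ≡ ∑ℕ k g
  ∑ℕ-cong zero    _   = refl
  ∑ℕ-cong (suc k) f≗g = cong₂ ℕ._+_ (∑ℕ-cong k (λ 1≤i i≤k → f≗g 1≤i (ℕ.m≤n⇒m≤1+n i≤k))) (f≗g (s≤s z≤n) ℕ.≤-refl)

  ∑ℕ-mono : ∀ k {f g : ℕ → ℕ} → (∀ i → f i ≤ g i) → ∑ℕ k f ≤ ∑ℕ k g
  ∑ℕ-mono zero    _   = z≤n
  ∑ℕ-mono (suc k) f≤g = ℕ.+-mono-≤ (∑ℕ-mono k f≤g) (f≤g (suc k))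

  ∑ℕ-term : ∀ k (f : ℕ → ℕ) {j} → 1 ≤ j → j ≤ k → f j ≤ ∑ℕ k f
  ∑ℕ-term zero    f (s≤s _) ()
  ∑ℕ-term (suc k) f 1≤j j≤1+k with ℕ.m≤n⇒m<n∨m≡n j≤1+k
  ... | inj₂ refl = ℕ.m≤n+m (f (suc k)) (∑ℕ k f)
  ... | inj₁ j<1+k = ℕ.≤-trans (∑ℕ-term k f 1≤j (ℕ.≤-pred j<1+k)) (ℕ.m≤m+n (∑ℕ k f) (f (suc k)))


module ColumnSums where

  open import Data.Bool using (Bool; true; false)
  open import Data.Nat using (ℕ; suc; _≤_; _<_; _≡ᵇ_; _⊓_; _∸_; z≤n; s≤s)
  import Data.Nat as ℕ
  import Data.Nat.Properties as ℕ
  open import Data.Integer using (ℤ; -[1+_]; 0ℤ; 1ℤ; _+_; _-_; _*_)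
  import Data.Integer.Properties as ℤ
  open import Data.Integer.Tactic.RingSolver using (solve-∀)
  open import Data.Product using (Σ; _×_; _,_)
  open import Data.Sum using (_⊎_; inj₁; inj₂)
  open import Relation.Binary.PropositionalEquality
  open import Relation.Nullary using (contradiction)
  open StandardPattern
  open IntegerSums

  private
    variable
      i j k : ℕ

  colSum : (ℕ → ℤ) → ℕ → ℤ
  colSum F k = ∑ k (λ i → F i * χ (standard k i))

  colSum-step : ∀ F j → colSum F (4 ℕ.+ j) ≡ colSum F (2 ℕ.+ j) - F (2 ℕ.+ j) + F (3 ℕ.+ j) + F (4 ℕ.+ j)
  colSum-step F j = begin
    ∑ (1 ℕ.+ j) (λ i → F i * χ (standard (4 ℕ.+ j) i)) + F (2 ℕ.+ j) * χ (standard (4 ℕ.+ j) (2 ℕ.+ j))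
      + F (3 ℕ.+ j) * χ (standard (4 ℕ.+ j) (3 ℕ.+ j)) + F (4 ℕ.+ j) * χ (standard (4 ℕ.+ j) (4 ℕ.+ j))
        ≡⟨ cong₂ _+_ (cong₂ _+_ (cong₂ _+_ (∑-cong (1 ℕ.+ j) (λ _ i≤1+j → cong (λ b → F _ * χ b) (standard-step 2≤2+j (s≤s i≤1+j))))
                                             (cong (λ b → F (2 ℕ.+ j) * χ b) (standard-step-diagonal 2≤2+j)))
                                (cong (λ b → F (3 ℕ.+ j) * χ b) (standard-step-superdiagonal 2≤2+j)))
                     (cong (λ b → F (4 ℕ.+ j) * χ b) (standard-diagonal {4 ℕ.+ j} (s≤s z≤n))) ⟩
    S + F (2 ℕ.+ j) * 0ℤ + F (3 ℕ.+ j) * 1ℤ + F (4 ℕ.+ j) * 1ℤ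
        ≡⟨ regroup S (F (2 ℕ.+ j)) (F (3 ℕ.+ j)) (F (4 ℕ.+ j)) ⟩
    S + F (2 ℕ.+ j) * 1ℤ - F (2 ℕ.+ j) + F (3 ℕ.+ j) + F (4 ℕ.+ j)
        ≡⟨ cong (λ b → S + F (2 ℕ.+ j) * χ b - F (2 ℕ.+ j) + F (3 ℕ.+ j) + F (4 ℕ.+ j)) (standard-diagonal {2 ℕ.+ j} (s≤s z≤n)) ⟨
    colSum F (2 ℕ.+ j) - F (2 ℕ.+ j) + F (3 ℕ.+ j) + F (4 ℕ.+ j)
        ∎
    where
    open ≡-Reasoning
    2≤2+j : 2 ≤ 2 ℕ.+ j
    2≤2+j = s≤s (s≤s z≤n)
    S = ∑ (1 ℕ.+ j) (λ i → F i * χ (standard (2 ℕ.+ j) i))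
    regroup : ∀ s a b c → s + a * 0ℤ + b * 1ℤ + c * 1ℤ ≡ s + a * 1ℤ - a + b + c
    regroup = solve-∀

  -- η = 𝟙ᵀΓ⁻¹ and γ = 𝟙ᵀΓ⁻² (colSum-η, colSum-γ); the recurrences are read off from colSum-step.
  η : ℕ → ℤ
  η 0 = 0ℤ
  η 1 = 1ℤ
  η 2 = 1ℤ
  η 3 = -[1+ 0 ]
  η (suc (suc (suc (suc j)))) = η (suc (suc j)) - η (suc (suc (suc j)))

  γ : ℕ → ℤ
  γ 0 = 0ℤ
  γ 1 = 1ℤ
  γ 2 = 1ℤ
  γ 3 = -[1+ 2 ]
  γ (suc (suc (suc (suc j)))) = γ (suc (suc j)) - γ (suc (suc (suc j))) - η (suc (suc (suc j)))

  colSum-η : 1 ≤ k → colSum η k ≡ 1ℤ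
  colSum-η {1} _ = refl
  colSum-η {2} _ = refl
  colSum-η {3} _ = refl
  colSum-η {suc (suc (suc (suc j)))} _ = begin
    colSum η (4 ℕ.+ j)                                                   ≡⟨ colSum-step η j ⟩
    colSum η (2 ℕ.+ j) - η (2 ℕ.+ j) + η (3 ℕ.+ j) + η (4 ℕ.+ j)         ≡⟨ cong (λ c → c - η (2 ℕ.+ j) + η (3 ℕ.+ j) + η (4 ℕ.+ j)) (colSum-η {suc (suc j)} (s≤s z≤n)) ⟩
    1ℤ - η (2 ℕ.+ j) + η (3 ℕ.+ j) + (η (2 ℕ.+ j) - η (3 ℕ.+ j))          ≡⟨ cancel (η (2 ℕ.+ j)) (η (3 ℕ.+ j)) ⟩
    1ℤ                                                                   ∎
    where
    open ≡-Reasoning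
    cancel : ∀ a b → 1ℤ - a + b + (a - b) ≡ 1ℤ
    cancel = solve-∀

  colSum-γ : 1 ≤ k → colSum γ k ≡ η k
  colSum-γ {1} _ = refl
  colSum-γ {2} _ = refl
  colSum-γ {3} _ = refl
  colSum-γ {suc (suc (suc (suc j)))} _ = begin
    colSum γ (4 ℕ.+ j)                                                   ≡⟨ colSum-step γ j ⟩
    colSum γ (2 ℕ.+ j) - γ (2 ℕ.+ j) + γ (3 ℕ.+ j) + γ (4 ℕ.+ j)         ≡⟨ cong (λ c → c - γ (2 ℕ.+ j) + γ (3 ℕ.+ j) + γ (4 ℕ.+ j)) (colSum-γ {suc (suc j)} (s≤s z≤n)) ⟩
    η (2 ℕ.+ j) - γ (2 ℕ.+ j) + γ (3 ℕ.+ j) + (γ (2 ℕ.+ j) - γ (3 ℕ.+ j) - η (3 ℕ.+ j))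
                                                                         ≡⟨ cancel (η (2 ℕ.+ j)) (η (3 ℕ.+ j)) (γ (2 ℕ.+ j)) (γ (3 ℕ.+ j)) ⟩
    η (4 ℕ.+ j)                                                          ∎
    where
    open ≡-Reasoning
    cancel : ∀ a b c d → a - c + d + (c - d - b) ≡ a - b
    cancel = solve-∀

  -- The shape of C₁, C₂, C₃, C₄, with (q, r) = (n − 2, 1), (n − 3, 2), (n − 3, 2), (n − 2, 1).
  record Extension (q r : ℕ) (c : ℕ → ℕ → Bool) : Set where
    field
      standard-column : ∀ i {k} → 1 ≤ k → k ≤ q → c i k ≡ standard k i
      copied-column   : ∀ {i j} → i < q → 1 ≤ j → j ≤ r → c i (j ℕ.+ q) ≡ standard q i
      identity-block  : ∀ {i j} → i ≤ r → 1 ≤ j → j ≤ r → c (i ℕ.+ q) (j ℕ.+ q) ≡ (i ≡ᵇ j)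

  ≤-or-beyond : ∀ k q → k ≤ q ⊎ Σ ℕ (λ j → 1 ≤ j × k ≡ j ℕ.+ q)
  ≤-or-beyond k q with ℕ.≤-<-connex k q
  ... | inj₁ k≤q = inj₁ k≤q
  ... | inj₂ q<k = inj₂ (k ∸ q , ℕ.m<n⇒0<n∸m q<k , sym (ℕ.m∸n+n≡m (ℕ.<⇒≤ q<k)))

  module _ {q r : ℕ} {c : ℕ → ℕ → Bool} (ext : Extension q r c) where
    open Extension ext

    extension-diagonal : 1 ≤ k → k ≤ r ℕ.+ q → c k k ≡ true
    extension-diagonal {k} 1≤k k≤m with ≤-or-beyond k q
    ... | inj₁ k≤q = trans (standard-column k 1≤k k≤q) (standard-diagonal 1≤k)
    ... | inj₂ (j , 1≤j , refl) = trans (identity-block j≤r 1≤j j≤r) (≡ᵇ-refl j)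
      where j≤r = ℕ.+-cancelʳ-≤ q j r k≤m

    extension-below : 1 ≤ k → k < i → i ≤ r ℕ.+ q → c i k ≡ false
    extension-below {k} {i} 1≤k k<i i≤m with ≤-or-beyond k q
    ... | inj₁ k≤q = trans (standard-column i 1≤k k≤q) (standard-below 1≤k k<i)
    ... | inj₂ (j , 1≤j , refl) with ≤-or-beyond i q
    ...   | inj₁ i≤q = contradiction (ℕ.<-≤-trans k<i i≤q) (ℕ.≤⇒≯ (ℕ.m≤n+m q j))
    ...   | inj₂ (j′ , _ , refl) = trans (identity-block (ℕ.+-cancelʳ-≤ q j′ r i≤m) 1≤j (ℕ.≤-trans (ℕ.<⇒≤ (ℕ.+-cancelʳ-< q j j′ k<i)) (ℕ.+-cancelʳ-≤ q j′ r i≤m)))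
                                         (>⇒≡ᵇ-false (ℕ.+-cancelʳ-< q j j′ k<i))

  module _ {p r : ℕ} {c : ℕ → ℕ → Bool} (ext : Extension (suc p) r c) (F : ℕ → ℤ) where
    open Extension ext
    private
      q = suc p
      column : ℕ → ℕ → ℤ
      column k i = F (i ⊓ q) * χ (c i k)

    extension-colSum : 1 ≤ k → k ≤ r ℕ.+ q → ∑ (r ℕ.+ q) (column k) ≡ colSum F (k ⊓ q)
    extension-colSum {k} 1≤k k≤m with ≤-or-beyond k q
    ... | inj₁ k≤q = begin
      ∑ (r ℕ.+ q) (column k)                   ≡⟨ ∑-vanishing (column k) k≤m (λ {i} k<i _ → trans (cong (λ b → F (i ⊓ q) * χ b)
                                                    (trans (standard-column i 1≤k k≤q) (standard-below 1≤k k<i))) (ℤ.*-zeroʳ (F (i ⊓ q)))) ⟩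
      ∑ k (column k)                           ≡⟨ ∑-cong k (λ {i} _ i≤k → cong₂ (λ x b → F x * χ b)
                                                    (ℕ.m≤n⇒m⊓n≡m (ℕ.≤-trans i≤k k≤q)) (standard-column i 1≤k k≤q)) ⟩
      colSum F k                               ≡⟨ cong (colSum F) (ℕ.m≤n⇒m⊓n≡m k≤q) ⟨
      colSum F (k ⊓ q)                         ∎
      where open ≡-Reasoning
    ... | inj₂ (j , 1≤j , refl) = begin
      ∑ (r ℕ.+ q) (column (j ℕ.+ q))                                     ≡⟨ ∑-split r q (column (j ℕ.+ q)) ⟩
      ∑ p (column (j ℕ.+ q)) + column (j ℕ.+ q) q + ∑ r (λ i → column (j ℕ.+ q) (i ℕ.+ q))
          ≡⟨ cong₂ _+_ (cong₂ _+_ copied above-block) (∑-single r _ 1≤j j≤r off-diagonal) ⟩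
      ∑ p (λ i → F i * χ (standard q i)) + 0ℤ + F ((j ℕ.+ q) ⊓ q) * χ (c (j ℕ.+ q) (j ℕ.+ q))
          ≡⟨ cong₂ (λ x b → ∑ p (λ i → F i * χ (standard q i)) + 0ℤ + F x * χ b) (ℕ.m≥n⇒m⊓n≡n (ℕ.m≤n+m q j))
                   (trans (identity-block j≤r 1≤j j≤r) (trans (≡ᵇ-refl j) (sym (standard-diagonal {q} (s≤s z≤n))))) ⟩
      ∑ p (λ i → F i * χ (standard q i)) + 0ℤ + F q * χ (standard q q)
          ≡⟨ cong (_+ F q * χ (standard q q)) (ℤ.+-identityʳ (∑ p (λ i → F i * χ (standard q i)))) ⟩
      colSum F q                                                        ≡⟨ cong (colSum F) (ℕ.m≥n⇒m⊓n≡n (ℕ.m≤n+m q j)) ⟨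
      colSum F ((j ℕ.+ q) ⊓ q)                                          ∎
      where
      open ≡-Reasoning
      j≤r = ℕ.+-cancelʳ-≤ q j r k≤m
      copied : ∑ p (column (j ℕ.+ q)) ≡ ∑ p (λ i → F i * χ (standard q i))
      copied = ∑-cong p (λ {i} 1≤i i≤p → cong₂ (λ x b → F x * χ b) (ℕ.m≤n⇒m⊓n≡m (ℕ.m≤n⇒m≤1+n i≤p)) (copied-column (s≤s i≤p) 1≤j j≤r))
      above-block : column (j ℕ.+ q) q ≡ 0ℤ
      above-block = trans (cong (λ b → F (q ⊓ q) * χ b) (trans (identity-block z≤n 1≤j j≤r) (<⇒≡ᵇ-false 1≤j))) (ℤ.*-zeroʳ (F (q ⊓ q)))
      off-diagonal : ∀ {i} → 1 ≤ i → i ≤ r → i ≢ j → column (j ℕ.+ q) (i ℕ.+ q) ≡ 0ℤ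
      off-diagonal {i} _ i≤r i≢j = trans (cong (λ b → F ((i ℕ.+ q) ⊓ q) * χ b) (trans (identity-block i≤r 1≤j j≤r) (≡ᵇ-false i≢j))) (ℤ.*-zeroʳ (F ((i ℕ.+ q) ⊓ q)))

  extension-from-copies : ∀ {q r c} (E : ℕ → ℕ → Bool) →
                          (∀ i {k} → 1 ≤ k → k ≤ q → c i k ≡ standard k i) →
                          (∀ i {j} → 1 ≤ j → j ≤ r → c i (j ℕ.+ q) ≡ E (j ℕ.+ q) i) →
                          (∀ {i k} → i < q → q < k → E k i ≡ standard q i) →
                          (∀ {i k} → q ≤ i → E k i ≡ (i ≡ᵇ k)) →
                          Extension q r c
  extension-from-copies {q} E standard-columns copies above block = record
    { standard-column = standard-columns
    ; copied-column   = λ {i} {j} i<q 1≤j j≤r → trans (copies i 1≤j j≤r) (above i<q (ℕ.<-≤-trans (ℕ.n<1+n q) (ℕ.+-monoˡ-≤ q 1≤j)))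
    ; identity-block  = λ {i} {j} _ 1≤j j≤r → trans (copies (i ℕ.+ q) 1≤j j≤r) (trans (block (ℕ.m≤n+m q i)) (≡ᵇ-cancelʳ q i j))
    }


module SubsetSums where

  open import Data.Bool using (Bool; true; false; if_then_else_)
  open import Data.Nat as ℕ using (ℕ; zero; suc; _≡ᵇ_; z≤n; s≤s)
  import Data.Nat.Properties as ℕ
  open import Data.Integer using (ℤ; +_; -[1+_]; 0ℤ; 1ℤ; _+_; _-_; _*_; -_; _≤_; +≤+; -≤+; ∣_∣)
  import Data.Integer.Properties as ℤ
  open import Data.Integer.Tactic.RingSolver using (solve-∀)
  open import Data.Product using (Σ; _×_; _,_; proj₁; proj₂)
  open import Data.Sum using (_⊎_; inj₁; inj₂)
  open import Function using (_∘_)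
  open import Relation.Binary.PropositionalEquality
  open import Relation.Nullary using (yes; no)
  open StandardPattern using (<⇒≡ᵇ-false; ≡ᵇ-refl)
  open IntegerSums

  posPart negPart : ℤ → ℤ
  posPart (+ n)      = + n
  posPart -[1+ n ]   = 0ℤ
  negPart (+ n)      = 0ℤ
  negPart -[1+ n ]   = -[1+ n ]

  negPart≤0 : ∀ x → negPart x ≤ 0ℤ
  negPart≤0 (+ n)    = ℤ.≤-refl
  negPart≤0 -[1+ n ] = -≤+

  0≤posPart : ∀ x → 0ℤ ≤ posPart x
  0≤posPart (+ n)    = +≤+ z≤n
  0≤posPart -[1+ n ] = ℤ.≤-refl

  ∑⁺ ∑⁻ : ℕ → (ℕ → ℤ) → ℤ
  ∑⁺ M g = ∑ M (posPart ∘ g)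
  ∑⁻ M g = ∑ M (negPart ∘ g)

  subsetSum : ℕ → (ℕ → ℤ) → (ℕ → Bool) → ℤ
  subsetSum M g t = ∑ M (λ i → g i * χ (t i))

  Complete : ℕ → (ℕ → ℤ) → Set
  Complete M g = ∀ {k} → k ℕ.< M → ∣ g (suc k) ∣ ℕ.≤ suc (∑ℕ k (∣_∣ ∘ g))

  ≤-by-difference : ∀ {x y} d → 0ℤ ≤ d → y ≡ x + d → x ≤ y
  ≤-by-difference {x} d 0≤d refl = ℤ.≤-trans (ℤ.≤-reflexive (sym (ℤ.+-identityʳ x))) (ℤ.+-monoʳ-≤ x 0≤d)

  ∑⁺-∑⁻ : ∀ M g → ∑⁺ M g ≡ ∑⁻ M g + + ∑ℕ M (∣_∣ ∘ g)
  ∑⁺-∑⁻ zero    g = refl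
  ∑⁺-∑⁻ (suc M) g = begin
    ∑⁺ M g + posPart x                                      ≡⟨ cong₂ _+_ (∑⁺-∑⁻ M g) (parts x) ⟩
    (∑⁻ M g + + ∑ℕ M (∣_∣ ∘ g)) + (negPart x + + ∣ x ∣)     ≡⟨ regroup (∑⁻ M g) (+ ∑ℕ M (∣_∣ ∘ g)) (negPart x) (+ ∣ x ∣) ⟩
    (∑⁻ M g + negPart x) + (+ ∑ℕ M (∣_∣ ∘ g) + + ∣ x ∣)     ≡⟨ cong (λ y → ∑⁻ M g + negPart x + y) (ℤ.pos-+ (∑ℕ M (∣_∣ ∘ g)) ∣ x ∣) ⟨
    ∑⁻ (suc M) g + + ∑ℕ (suc M) (∣_∣ ∘ g)                   ∎
    where
    open ≡-Reasoning
    x = g (suc M)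
    parts : ∀ x → posPart x ≡ negPart x + + ∣ x ∣
    parts (+ n)    = refl
    parts -[1+ n ] = sym (ℤ.+-inverseˡ (+ suc n))
    regroup : ∀ a b c d → (a + b) + (c + d) ≡ (a + c) + (b + d)
    regroup = solve-∀

  subsetSum-bounds : ∀ M g t → ∑⁻ M g ≤ subsetSum M g t × subsetSum M g t ≤ ∑⁺ M g
  subsetSum-bounds zero    g t = ℤ.≤-refl , ℤ.≤-refl
  subsetSum-bounds (suc M) g t = ℤ.+-mono-≤ lower (proj₁ (term (g (suc M)) (t (suc M)))) , ℤ.+-mono-≤ upper (proj₂ (term (g (suc M)) (t (suc M))))
    where
    lower = proj₁ (subsetSum-bounds M g t)
    upper = proj₂ (subsetSum-bounds M g t)
    term : ∀ x b → negPart x ≤ x * χ b × x * χ b ≤ posPart x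
    term (+ n)    true  = subst (0ℤ ≤_) (sym (ℤ.*-identityʳ (+ n))) (+≤+ z≤n) , ℤ.≤-reflexive (ℤ.*-identityʳ (+ n))
    term (+ n)    false = ℤ.≤-reflexive (sym (ℤ.*-zeroʳ (+ n))) , subst (_≤ + n) (sym (ℤ.*-zeroʳ (+ n))) (+≤+ z≤n)
    term -[1+ n ] true  = ℤ.≤-reflexive (sym (ℤ.*-identityʳ -[1+ n ])) , subst (_≤ 0ℤ) (sym (ℤ.*-identityʳ -[1+ n ])) -≤+
    term -[1+ n ] false = subst (-[1+ n ] ≤_) (sym (ℤ.*-zeroʳ -[1+ n ])) -≤+ , ℤ.≤-reflexive (ℤ.*-zeroʳ -[1+ n ])

  -- [N, N + A] and its translate by x overlap or touch, since ∣ x ∣ ≤ 1 + A.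
  interval-step : ∀ {N A s} x → ∣ x ∣ ℕ.≤ suc A → N + negPart x ≤ s → s ≤ (N + + A) + posPart x →
                  (N ≤ s × s ≤ N + + A) ⊎ (N ≤ s - x × s - x ≤ N + + A)
  interval-step {N} {A} {s} (+ a) a≤1+A lo hi with s ℤ.≤? N + + A
  ... | yes s≤P = inj₁ (subst (_≤ s) (ℤ.+-identityʳ N) lo , s≤P)
  ... | no  s≰P = inj₂ (≤-by-difference ((s - (1ℤ + (N + + A))) + ((1ℤ + + A) - + a))
                          (ℤ.+-mono-≤ (ℤ.i≤j⇒0≤j-i (ℤ.i<j⇒suc[i]≤j (ℤ.≰⇒> s≰P))) (ℤ.i≤j⇒0≤j-i (+≤+ a≤1+A))) (identity₁ N (+ A) s (+ a)) ,
                        ≤-by-difference ((N + + A + + a) - s) (ℤ.i≤j⇒0≤j-i hi) (identity₂ N (+ A) s (+ a)))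
    where
    identity₁ : ∀ N A s a → s - a ≡ N + ((s - (1ℤ + (N + A))) + ((1ℤ + A) - a))
    identity₁ = solve-∀
    identity₂ : ∀ N A s a → N + A ≡ (s - a) + ((N + A + a) - s)
    identity₂ = solve-∀
  interval-step {N} {A} {s} -[1+ a ] 1+a≤1+A lo hi with N ℤ.≤? s
  ... | yes N≤s = inj₁ (N≤s , subst (s ≤_) (ℤ.+-identityʳ (N + + A)) hi)
  ... | no  N≰s = inj₂ (≤-by-difference (s - (N + -[1+ a ])) (ℤ.i≤j⇒0≤j-i lo) (identity₁ N s (+ suc a)) ,
                        ≤-by-difference ((N - (1ℤ + s)) + (+ A - + a))
                          (ℤ.+-mono-≤ (ℤ.i≤j⇒0≤j-i (ℤ.i<j⇒suc[i]≤j (ℤ.≰⇒> N≰s))) (ℤ.i≤j⇒0≤j-i (+≤+ (ℕ.≤-pred 1+a≤1+A))))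
                          (identity₂ N (+ A) s (+ a)))
    where
    identity₁ : ∀ N s b → s - - b ≡ N + (s - (N + - b))
    identity₁ = solve-∀
    identity₂ : ∀ N A s a → N + A ≡ (s - - (1ℤ + a)) + ((N - (1ℤ + s)) + (A - a))
    identity₂ = solve-∀

  update : (ℕ → Bool) → ℕ → Bool → ℕ → Bool
  update t k b i = if i ≡ᵇ k then b else t i

  subsetSum-update : ∀ M g t b → subsetSum (suc M) g (update t (suc M) b) ≡ subsetSum M g t + g (suc M) * χ b
  subsetSum-update M g t b = cong₂ _+_
    (∑-cong M (λ {i} _ i≤M → cong (λ c → g i * χ (if c then b else t i)) (<⇒≡ᵇ-false (s≤s i≤M))))
    (cong (λ c → g (suc M) * χ (if c then b else t (suc M))) (≡ᵇ-refl M))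

  Complete-pred : ∀ {M g} → Complete (suc M) g → Complete M g
  Complete-pred complete k<M = complete (ℕ.m≤n⇒m≤1+n k<M)

  subsetSum-surjective : ∀ M g → Complete M g → ∀ {s} → ∑⁻ M g ≤ s → s ≤ ∑⁺ M g → Σ (ℕ → Bool) (λ t → subsetSum M g t ≡ s)
  subsetSum-surjective zero    g _ lo hi = (λ _ → false) , ℤ.≤-antisym lo hi
  subsetSum-surjective (suc M) g complete {s} lo hi
    with interval-step (g (suc M)) (complete ℕ.≤-refl) lo (subst (λ P → s ≤ P + posPart (g (suc M))) (∑⁺-∑⁻ M g) hi)
  ... | inj₁ (lo′ , hi′) with subsetSum-surjective M g (Complete-pred {g = g} complete) lo′ (subst (s ≤_) (sym (∑⁺-∑⁻ M g)) hi′)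
  ...   | t , sum≡s = update t (suc M) false ,
                      trans (subsetSum-update M g t false) (trans (cong₂ _+_ sum≡s (ℤ.*-zeroʳ (g (suc M)))) (ℤ.+-identityʳ s))
  subsetSum-surjective (suc M) g complete {s} lo hi
      | inj₂ (lo′ , hi′) with subsetSum-surjective M g (Complete-pred {g = g} complete) lo′ (subst (s - g (suc M) ≤_) (sym (∑⁺-∑⁻ M g)) hi′)
  ...   | t , sum≡s-x = update t (suc M) true ,
                        trans (subsetSum-update M g t true) (trans (cong₂ _+_ sum≡s-x (ℤ.*-identityʳ (g (suc M)))) (cancel s (g (suc M))))
    where
    cancel : ∀ s x → s - x + x ≡ s
    cancel = solve-∀

  private
    ≤-shiftˡ : ∀ {x a s} → x + a ≤ s → a ≤ s - x
    ≤-shiftˡ {x} {a} {s} x+a≤s = ≤-by-difference (s - (x + a)) (ℤ.i≤j⇒0≤j-i x+a≤s) (identity x a s)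
      where
      identity : ∀ x a s → s - x ≡ a + (s - (x + a))
      identity = solve-∀

    ≤-shiftʳ : ∀ {x b s} → s ≤ x + b → s - x ≤ b
    ≤-shiftʳ {x} {b} {s} s≤x+b = ≤-by-difference ((x + b) - s) (ℤ.i≤j⇒0≤j-i s≤x+b) (identity x b s)
      where
      identity : ∀ x b s → b ≡ (s - x) + ((x + b) - s)
      identity = solve-∀

  subsetSum-surjective-shifted : ∀ x M g → Complete M g → ∀ {s} → x + ∑⁻ M g ≤ s → s ≤ x + ∑⁺ M g →
                                 Σ (ℕ → Bool) (λ t → x + subsetSum M g t ≡ s)
  subsetSum-surjective-shifted x M g complete {s} lo hi with subsetSum-surjective M g complete (≤-shiftˡ lo) (≤-shiftʳ hi)
  ... | t , sum≡s-x = t , trans (cong (λ y → x + y) sum≡s-x) (cancel x s)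
    where
    cancel : ∀ x s → x + (s - x) ≡ s
    cancel = solve-∀

  interval-union : ∀ {P : ℤ → Set} {a b c e} → (∀ {s} → a ≤ s → s ≤ b → P s) → (∀ {s} → c ≤ s → s ≤ e → P s) →
                   c ≤ b + 1ℤ → ∀ {s} → a ≤ s → s ≤ e → P s
  interval-union {b = b} first second c≤b+1 {s} a≤s s≤e with s ℤ.≤? b
  ... | yes s≤b = first a≤s s≤b
  ... | no  s≰b = second (ℤ.≤-trans c≤b+1 (subst (_≤ s) (ℤ.+-comm 1ℤ b) (ℤ.i<j⇒suc[i]≤j (ℤ.≰⇒> s≰b)))) s≤e


module FibonacciBounds where

  open import Data.Nat using (ℕ; zero; suc; _+_; _≤_; _⊓_; z≤n; s≤s)
  import Data.Nat.Properties as ℕ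
  import Data.Nat.Tactic.RingSolver as ℕ-Solver
  open import Data.Integer as ℤ using (ℤ; +_; 1ℤ; ∣_∣)
  import Data.Integer.Properties as ℤ
  open import Data.Integer.Tactic.RingSolver using (solve-∀)
  open import Data.Product using (Σ; _,_)
  open import Data.Sum using (_⊎_; inj₁; inj₂)
  open import Relation.Binary.PropositionalEquality
  open import Relation.Nullary using (yes; no)
  open import Function using (_∘_)
  open IntegerSums
  open ColumnSums
  open SubsetSums

  double : ℕ → ℕ
  double zero    = zero
  double (suc t) = suc (suc (double t))

  α : ℕ → ℕ
  α 0 = 0
  α 1 = 1
  α 2 = 1
  α 3 = 3
  α (suc (suc (suc (suc j)))) = α (suc (suc (suc j))) + α (suc (suc j)) + fib (suc (suc j))

  private
    +-minus-neg : ∀ a b → + a ℤ.- ℤ.- + b ≡ + (b + a)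
    +-minus-neg a b = trans (identity (+ a) (+ b)) (sym (ℤ.pos-+ b a))
      where
      identity : ∀ x y → x ℤ.- ℤ.- y ≡ y ℤ.+ x
      identity = solve-∀

    neg-minus-+ : ∀ a b → ℤ.- + a ℤ.- + b ≡ ℤ.- + (b + a)
    neg-minus-+ a b = trans (identity (+ a) (+ b)) (cong ℤ.-_ (sym (ℤ.pos-+ b a)))
      where
      identity : ∀ x y → ℤ.- x ℤ.- y ≡ ℤ.- (y ℤ.+ x)
      identity = solve-∀

  η-even : ∀ t → η (2 + double t) ≡ + fib (1 + double t)
  η-odd  : ∀ t → η (3 + double t) ≡ ℤ.- + fib (2 + double t)
  η-even zero    = refl
  η-even (suc t) = trans (cong₂ ℤ._-_ (η-even t) (η-odd t)) (+-minus-neg (fib (1 + double t)) (fib (2 + double t)))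
  η-odd  zero    = refl
  η-odd  (suc t) = trans (cong₂ ℤ._-_ (η-odd t) (η-even (suc t))) (neg-minus-+ (fib (2 + double t)) (fib (3 + double t)))

  private
    signed-sum₁ : ∀ a b c → + a ℤ.- ℤ.- + b ℤ.- ℤ.- + c ≡ + (b + a + c)
    signed-sum₁ a b c = trans (identity (+ a) (+ b) (+ c)) (sym (trans (ℤ.pos-+ (b + a) c) (cong (ℤ._+ + c) (ℤ.pos-+ b a))))
      where
      identity : ∀ x y z → x ℤ.- ℤ.- y ℤ.- ℤ.- z ≡ y ℤ.+ x ℤ.+ z
      identity = solve-∀

    signed-sum₂ : ∀ a b c → ℤ.- + a ℤ.- + b ℤ.- + c ≡ ℤ.- + (b + a + c)
    signed-sum₂ a b c = trans (identity (+ a) (+ b) (+ c)) (sym (cong ℤ.-_ (trans (ℤ.pos-+ (b + a) c) (cong (ℤ._+ + c) (ℤ.pos-+ b a)))))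
      where
      identity : ∀ x y z → ℤ.- x ℤ.- y ℤ.- z ≡ ℤ.- (y ℤ.+ x ℤ.+ z)
      identity = solve-∀

  γ-even : ∀ t → γ (2 + double t) ≡ + α (2 + double t)
  γ-odd  : ∀ t → γ (3 + double t) ≡ ℤ.- + α (3 + double t)
  γ-even zero    = refl
  γ-even (suc t) = trans (cong₂ ℤ._-_ (cong₂ ℤ._-_ (γ-even t) (γ-odd t)) (η-odd t))
                         (signed-sum₁ (α (2 + double t)) (α (3 + double t)) (fib (2 + double t)))
  γ-odd  zero    = refl
  γ-odd  (suc t) = trans (cong₂ ℤ._-_ (cong₂ ℤ._-_ (γ-odd t) (γ-even (suc t))) (η-even (suc t)))
                         (signed-sum₂ (α (3 + double t)) (α (4 + double t)) (fib (3 + double t)))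

  double-or-odd : ∀ k → Σ ℕ (λ t → k ≡ double t ⊎ k ≡ suc (double t))
  double-or-odd zero = 0 , inj₁ refl
  double-or-odd (suc zero) = 0 , inj₂ refl
  double-or-odd (suc (suc k)) with double-or-odd k
  ... | t , inj₁ refl = suc t , inj₁ refl
  ... | t , inj₂ refl = suc t , inj₂ refl

  ∣γ∣≡α : ∀ {k} → 1 ≤ k → ∣ γ k ∣ ≡ α k
  ∣γ∣≡α {1} _ = refl
  ∣γ∣≡α {suc (suc k)} _ with double-or-odd k
  ... | t , inj₁ refl = cong ∣_∣ (γ-even t)
  ... | t , inj₂ refl = trans (cong ∣_∣ (γ-odd t)) (ℤ.∣-i∣≡∣i∣ (+ α (3 + double t)))

  1+∑ℕ-fib : ∀ k → suc (∑ℕ k fib) ≡ fib (2 + k)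
  1+∑ℕ-fib zero    = refl
  1+∑ℕ-fib (suc k) = cong (_+ fib (suc k)) (1+∑ℕ-fib k)

  fib≤α : ∀ k → fib k ≤ α k
  fib≤α 0 = z≤n
  fib≤α 1 = ℕ.≤-refl
  fib≤α 2 = ℕ.≤-refl
  fib≤α 3 = s≤s (s≤s z≤n)
  fib≤α (suc (suc (suc (suc j)))) = ℕ.≤-trans (ℕ.+-mono-≤ (fib≤α (suc (suc (suc j)))) (fib≤α (suc (suc j)))) (ℕ.m≤m+n _ (fib (2 + j)))

  α-complete : ∀ k → α (suc k) ≤ suc (∑ℕ k α)
  α-complete 0 = ℕ.≤-refl
  α-complete 1 = s≤s z≤n
  α-complete 2 = ℕ.≤-refl
  α-complete (suc (suc (suc j))) = begin
    α (3 + j) + α (2 + j) + fib (2 + j)                       ≤⟨ ℕ.+-monoʳ-≤ (α (3 + j) + α (2 + j)) fib≤1+∑α ⟩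
    α (3 + j) + α (2 + j) + suc (∑ℕ (1 + j) α)               ≡⟨ regroup (α (3 + j)) (α (2 + j)) (∑ℕ (1 + j) α) ⟩
    suc (∑ℕ (1 + j) α + α (2 + j) + α (3 + j))               ∎
    where
    open ℕ.≤-Reasoning
    fib≤1+∑α : fib (2 + j) ≤ suc (∑ℕ (1 + j) α)
    fib≤1+∑α = ℕ.≤-trans (ℕ.m≤m+n (fib (2 + j)) (fib (1 + j)))
               (subst (_≤ suc (∑ℕ (1 + j) α)) (1+∑ℕ-fib (1 + j)) (s≤s (∑ℕ-mono (1 + j) fib≤α)))
    regroup : ∀ a b s → a + b + suc s ≡ suc (s + b + a)
    regroup = ℕ-Solver.solve-∀

  double-fib≤α : ∀ j → fib (2 + j) + fib (2 + j) ≤ α (3 + j)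
  double-fib≤α 0 = s≤s (s≤s z≤n)
  double-fib≤α 1 = s≤s (s≤s (s≤s (s≤s z≤n)))
  double-fib≤α (suc (suc j)) = begin
    fib (4 + j) + fib (4 + j)                                   ≡⟨ regroup (fib (3 + j)) (fib (2 + j)) ⟩
    (fib (3 + j) + fib (3 + j)) + (fib (2 + j) + fib (2 + j))   ≤⟨ ℕ.+-mono-≤ (double-fib≤α (suc j)) (double-fib≤α j) ⟩
    α (4 + j) + α (3 + j)                                       ≤⟨ ℕ.m≤m+n _ (fib (3 + j)) ⟩
    α (5 + j)                                                   ∎
    where
    open ℕ.≤-Reasoning
    regroup : ∀ a b → (a + b) + (a + b) ≡ (a + a) + (b + b)
    regroup = ℕ-Solver.solve-∀

  double-fib≤1+∑α : ∀ j → fib (4 + j) + fib (4 + j) ≤ suc (∑ℕ (3 + j) α)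
  double-fib≤1+∑α 0 = ℕ.≤-refl
  double-fib≤1+∑α (suc j) = begin
    fib (5 + j) + fib (5 + j)                                   ≡⟨ regroup (fib (4 + j)) (fib (3 + j)) ⟩
    (fib (4 + j) + fib (4 + j)) + (fib (3 + j) + fib (3 + j))   ≤⟨ ℕ.+-mono-≤ (double-fib≤1+∑α j) (double-fib≤α (suc j)) ⟩
    suc (∑ℕ (3 + j) α) + α (4 + j)                              ∎
    where
    open ℕ.≤-Reasoning
    regroup : ∀ a b → (a + b) + (a + b) ≡ (a + a) + (b + b)
    regroup = ℕ-Solver.solve-∀

  γ-truncated-complete : ∀ {M q} → 1 ≤ q → Complete M (λ i → γ (i ⊓ q))
  γ-truncated-complete {q = q} 1≤q {k} _ with suc k ℕ.≤? q
  ... | yes 1+k≤q = begin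
    ∣ γ (suc k ⊓ q) ∣                  ≡⟨ cong (λ i → ∣ γ i ∣) (ℕ.m≤n⇒m⊓n≡m 1+k≤q) ⟩
    ∣ γ (suc k) ∣                      ≡⟨ ∣γ∣≡α {suc k} (s≤s z≤n) ⟩
    α (suc k)                          ≤⟨ α-complete k ⟩
    suc (∑ℕ k α)                       ≡⟨ cong suc (∑ℕ-cong k (λ 1≤i i≤k →
                                            trans (sym (∣γ∣≡α 1≤i)) (cong (λ i → ∣ γ i ∣) (sym (ℕ.m≤n⇒m⊓n≡m (ℕ.≤-trans (ℕ.m≤n⇒m≤1+n i≤k) 1+k≤q)))))) ⟩
    suc (∑ℕ k (λ i → ∣ γ (i ⊓ q) ∣))  ∎
    where open ℕ.≤-Reasoning
  ... | no 1+k≰q = begin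
    ∣ γ (suc k ⊓ q) ∣                  ≡⟨ cong (λ i → ∣ γ i ∣) (trans (ℕ.m≥n⇒m⊓n≡n (ℕ.<⇒≤ q<1+k)) (sym (ℕ.⊓-idem q))) ⟩
    ∣ γ (q ⊓ q) ∣                      ≤⟨ ∑ℕ-term k (λ i → ∣ γ (i ⊓ q) ∣) 1≤q (ℕ.≤-pred q<1+k) ⟩
    ∑ℕ k (λ i → ∣ γ (i ⊓ q) ∣)        ≤⟨ ℕ.n≤1+n _ ⟩
    suc (∑ℕ k (λ i → ∣ γ (i ⊓ q) ∣))  ∎
    where
    open ℕ.≤-Reasoning
    q<1+k = ℕ.≰⇒> 1+k≰q

  private
    shift-last : ∀ P x y {v} → P ℤ.+ x ≡ v → P ℤ.+ y ℤ.+ y ≡ v ℤ.- x ℤ.+ y ℤ.+ y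
    shift-last P x y refl = identity P x y
      where
      identity : ∀ P x y → P ℤ.+ y ℤ.+ y ≡ P ℤ.+ x ℤ.- x ℤ.+ y ℤ.+ y
      identity = solve-∀

  η-partial-even : ∀ t → ∑ (2 + double t) η ℤ.+ η (2 + double t) ≡ + 2 ℤ.+ + fib (2 + double t)
  η-partial-odd  : ∀ t → ∑ (3 + double t) η ℤ.+ η (3 + double t) ≡ + 2 ℤ.- + fib (3 + double t)
  η-partial-even zero    = refl
  η-partial-even (suc t) = begin
    ∑ (3 + d) η ℤ.+ η (4 + d) ℤ.+ η (4 + d)                           ≡⟨ shift-last (∑ (3 + d) η) (η (3 + d)) (η (4 + d)) (η-partial-odd t) ⟩
    + 2 ℤ.- + fib (3 + d) ℤ.- η (3 + d) ℤ.+ η (4 + d) ℤ.+ η (4 + d)   ≡⟨ cong₂ (λ x y → + 2 ℤ.- + fib (3 + d) ℤ.- x ℤ.+ y ℤ.+ y) (η-odd t) (η-even (suc t)) ⟩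
    + 2 ℤ.- + fib (3 + d) ℤ.- ℤ.- + fib (2 + d) ℤ.+ + fib (3 + d) ℤ.+ + fib (3 + d)
                                                                      ≡⟨ identity (+ fib (3 + d)) (+ fib (2 + d)) ⟩
    + 2 ℤ.+ (+ fib (3 + d) ℤ.+ + fib (2 + d))                         ≡⟨ cong (λ x → + 2 ℤ.+ x) (ℤ.pos-+ (fib (3 + d)) (fib (2 + d))) ⟨
    + 2 ℤ.+ + fib (4 + d)                                             ∎
    where
    open ≡-Reasoning
    d = double t
    identity : ∀ a b → + 2 ℤ.- a ℤ.- ℤ.- b ℤ.+ a ℤ.+ a ≡ + 2 ℤ.+ (a ℤ.+ b)
    identity = solve-∀
  η-partial-odd  zero    = refl
  η-partial-odd  (suc t) = begin
    ∑ (4 + d) η ℤ.+ η (5 + d) ℤ.+ η (5 + d)                           ≡⟨ shift-last (∑ (4 + d) η) (η (4 + d)) (η (5 + d)) (η-partial-even (suc t)) ⟩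
    + 2 ℤ.+ + fib (4 + d) ℤ.- η (4 + d) ℤ.+ η (5 + d) ℤ.+ η (5 + d)   ≡⟨ cong₂ (λ x y → + 2 ℤ.+ + fib (4 + d) ℤ.- x ℤ.+ y ℤ.+ y) (η-even (suc t)) (η-odd (suc t)) ⟩
    + 2 ℤ.+ + fib (4 + d) ℤ.- + fib (3 + d) ℤ.+ ℤ.- + fib (4 + d) ℤ.+ ℤ.- + fib (4 + d)
                                                                      ≡⟨ identity (+ fib (4 + d)) (+ fib (3 + d)) ⟩
    + 2 ℤ.- (+ fib (4 + d) ℤ.+ + fib (3 + d))                         ≡⟨ cong (λ x → + 2 ℤ.- x) (ℤ.pos-+ (fib (4 + d)) (fib (3 + d))) ⟨
    + 2 ℤ.- + fib (5 + d)                                             ∎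
    where
    open ≡-Reasoning
    d = double t
    identity : ∀ a b → + 2 ℤ.+ a ℤ.- b ℤ.+ ℤ.- a ℤ.+ ℤ.- a ≡ + 2 ℤ.- (a ℤ.+ b)
    identity = solve-∀

  families-adjacent : ∀ {q₀ qᵤ qₗ Mᵤ Mₗ} F → q₀ ≤ qᵤ → q₀ ≤ qₗ → q₀ ≤ Mᵤ → q₀ ≤ Mₗ → F + F ≤ suc (∑ℕ q₀ α) →
                      (+ 2 ℤ.+ + F) ℤ.+ ∑⁻ Mᵤ (λ i → γ (i ⊓ qᵤ)) ℤ.≤ (+ 2 ℤ.- + F) ℤ.+ ∑⁺ Mₗ (λ i → γ (i ⊓ qₗ)) ℤ.+ 1ℤ
  families-adjacent {q₀} {qᵤ} {qₗ} {Mᵤ} {Mₗ} F q₀≤qᵤ q₀≤qₗ q₀≤Mᵤ q₀≤Mₗ 2F≤1+A = begin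
    (+ 2 ℤ.+ + F) ℤ.+ ∑⁻ Mᵤ γᵤ               ≤⟨ ℤ.+-monoʳ-≤ (+ 2 ℤ.+ + F) (ℤ.≤-trans (∑-antitone _ (negPart≤0 ∘ γᵤ) q₀≤Mᵤ)
                                                   (ℤ.≤-reflexive (∑-cong q₀ (λ _ i≤q₀ → cong (negPart ∘ γ) (ℕ.m≤n⇒m⊓n≡m (ℕ.≤-trans i≤q₀ q₀≤qᵤ)))))) ⟩
    (+ 2 ℤ.+ + F) ℤ.+ N                       ≤⟨ ≤-by-difference (+ suc A ℤ.- + (F + F)) (ℤ.i≤j⇒0≤j-i (ℤ.+≤+ 2F≤1+A)) identity ⟩
    (+ 2 ℤ.- + F) ℤ.+ (N ℤ.+ + A) ℤ.+ 1ℤ     ≡⟨ cong (λ x → (+ 2 ℤ.- + F) ℤ.+ x ℤ.+ 1ℤ) (sym ∑⁺q₀) ⟩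
    (+ 2 ℤ.- + F) ℤ.+ ∑⁺ q₀ γₗ ℤ.+ 1ℤ         ≤⟨ ℤ.+-monoˡ-≤ 1ℤ (ℤ.+-monoʳ-≤ (+ 2 ℤ.- + F) (∑-monotone _ (0≤posPart ∘ γₗ) q₀≤Mₗ)) ⟩
    (+ 2 ℤ.- + F) ℤ.+ ∑⁺ Mₗ γₗ ℤ.+ 1ℤ         ∎
    where
    open ℤ.≤-Reasoning
    γᵤ γₗ : ℕ → ℤ
    γᵤ i = γ (i ⊓ qᵤ)
    γₗ i = γ (i ⊓ qₗ)
    N = ∑⁻ q₀ γ
    A = ∑ℕ q₀ α
    ∑⁺q₀ : ∑⁺ q₀ γₗ ≡ N ℤ.+ + A
    ∑⁺q₀ = begin-equality
      ∑⁺ q₀ γₗ                                         ≡⟨ ∑-cong q₀ (λ _ i≤q₀ → cong (posPart ∘ γ) (ℕ.m≤n⇒m⊓n≡m (ℕ.≤-trans i≤q₀ q₀≤qₗ))) ⟩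
      ∑⁺ q₀ γ                                          ≡⟨ ∑⁺-∑⁻ q₀ γ ⟩
      N ℤ.+ + ∑ℕ q₀ (∣_∣ ∘ γ)                          ≡⟨ cong (λ a → N ℤ.+ + a) (∑ℕ-cong q₀ (λ 1≤i _ → ∣γ∣≡α 1≤i)) ⟩
      N ℤ.+ + A                                        ∎
    identity : (+ 2 ℤ.- + F) ℤ.+ (N ℤ.+ + A) ℤ.+ 1ℤ ≡ (+ 2 ℤ.+ + F) ℤ.+ N ℤ.+ (+ suc A ℤ.- + (F + F))
    identity = trans (ring (+ F) N (+ A)) (cong (λ x → (+ 2 ℤ.+ + F) ℤ.+ N ℤ.+ (+ suc A ℤ.- x)) (sym (ℤ.pos-+ F F)))
      where
      ring : ∀ f n a → (+ 2 ℤ.- f) ℤ.+ (n ℤ.+ a) ℤ.+ 1ℤ ≡ (+ 2 ℤ.+ f) ℤ.+ n ℤ.+ (1ℤ ℤ.+ a ℤ.- (f ℤ.+ f))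
      ring = solve-∀


module IntegerMatrices where

  open import Data.Bool using (Bool; true; false)
  open import Data.Nat as ℕ using (ℕ; zero; suc; z≤n; s≤s)
  open import Data.Fin as Fin using (Fin; toℕ; fromℕ; inject₁)
  import Data.Fin.Properties as Fin
  open import Data.Integer as ℤ using (ℤ; +_; 1ℤ)
  import Data.Integer.Properties as ℤ
  open import Data.Integer.Tactic.RingSolver using (solve-∀)
  open import Data.Rational as ℚ using (ℚ; 0ℚ; 1ℚ)
  import Data.Rational.Properties as ℚ
  import Data.Rational.Unnormalised as ℚᵘ
  import Data.Rational.Unnormalised.Properties as ℚᵘ
  open import Data.Sum using (_⊎_; inj₁; inj₂)
  open import Function using (_∘_)
  open import Relation.Binary.PropositionalEquality
  open Matrices
  open IntegerSums

  private
    -- ℤ→ℚ a = a / 1 is definitionally fromℚᵘ (mkℚᵘ a 0).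
    toℚᵘ-ℤ→ℚ : ∀ a → ℚᵘ._≃_ (ℚ.toℚᵘ (ℤ→ℚ a)) (ℚᵘ.mkℚᵘ a 0)
    toℚᵘ-ℤ→ℚ a = ℚ.toℚᵘ-fromℚᵘ (ℚᵘ.mkℚᵘ a 0)

  ℤ→ℚ-+ : ∀ a b → ℤ→ℚ (a ℤ.+ b) ≡ ℤ→ℚ a ℚ.+ ℤ→ℚ b
  ℤ→ℚ-+ a b = ℚ.toℚᵘ-injective (begin
    ℚ.toℚᵘ (ℤ→ℚ (a ℤ.+ b))                   ≈⟨ toℚᵘ-ℤ→ℚ (a ℤ.+ b) ⟩
    ℚᵘ.mkℚᵘ (a ℤ.+ b) 0                      ≈⟨ ℚᵘ.*≡* (identity a b) ⟩
    ℚᵘ.mkℚᵘ a 0 ℚᵘ.+ ℚᵘ.mkℚᵘ b 0              ≈⟨ ℚᵘ.+-cong (toℚᵘ-ℤ→ℚ a) (toℚᵘ-ℤ→ℚ b) ⟨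
    ℚ.toℚᵘ (ℤ→ℚ a) ℚᵘ.+ ℚ.toℚᵘ (ℤ→ℚ b)      ≈⟨ ℚ.toℚᵘ-homo-+ (ℤ→ℚ a) (ℤ→ℚ b) ⟨
    ℚ.toℚᵘ (ℤ→ℚ a ℚ.+ ℤ→ℚ b)                 ∎)
    where
    open ℚᵘ.≃-Reasoning
    identity : ∀ a b → (a ℤ.+ b) ℤ.* 1ℤ ≡ (a ℤ.* 1ℤ ℤ.+ b ℤ.* 1ℤ) ℤ.* 1ℤ
    identity = solve-∀

  ℤ→ℚ-* : ∀ a b → ℤ→ℚ (a ℤ.* b) ≡ ℤ→ℚ a ℚ.* ℤ→ℚ b
  ℤ→ℚ-* a b = ℚ.toℚᵘ-injective (begin
    ℚ.toℚᵘ (ℤ→ℚ (a ℤ.* b))                   ≈⟨ toℚᵘ-ℤ→ℚ (a ℤ.* b) ⟩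
    ℚᵘ.mkℚᵘ a 0 ℚᵘ.* ℚᵘ.mkℚᵘ b 0              ≈⟨ ℚᵘ.*-cong (toℚᵘ-ℤ→ℚ a) (toℚᵘ-ℤ→ℚ b) ⟨
    ℚ.toℚᵘ (ℤ→ℚ a) ℚᵘ.* ℚ.toℚᵘ (ℤ→ℚ b)      ≈⟨ ℚ.toℚᵘ-homo-* (ℤ→ℚ a) (ℤ→ℚ b) ⟨
    ℚ.toℚᵘ (ℤ→ℚ a ℚ.* ℤ→ℚ b)                 ∎)
    where open ℚᵘ.≃-Reasoning

  ℤ→ℚ-neg : ∀ a → ℤ→ℚ (ℤ.- a) ≡ ℚ.- ℤ→ℚ a
  ℤ→ℚ-neg a = ℚ.toℚᵘ-injective (begin
    ℚ.toℚᵘ (ℤ→ℚ (ℤ.- a))          ≈⟨ toℚᵘ-ℤ→ℚ (ℤ.- a) ⟩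
    ℚᵘ.- ℚᵘ.mkℚᵘ a 0               ≈⟨ ℚᵘ.-‿cong (toℚᵘ-ℤ→ℚ a) ⟨
    ℚᵘ.- ℚ.toℚᵘ (ℤ→ℚ a)           ≈⟨ ℚ.toℚᵘ-homo‿- (ℤ→ℚ a) ⟨
    ℚ.toℚᵘ (ℚ.- ℤ→ℚ a)            ∎)
    where open ℚᵘ.≃-Reasoning

  ℤ→ℚ-minus : ∀ a b → ℤ→ℚ (a ℤ.- b) ≡ ℤ→ℚ a ℚ.- ℤ→ℚ b
  ℤ→ℚ-minus a b = trans (ℤ→ℚ-+ a (ℤ.- b)) (cong (ℤ→ℚ a ℚ.+_) (ℤ→ℚ-neg b))

  ℤ→ℚ-cancel-≤ : ∀ {a b} → ℤ→ℚ a ℚ.≤ ℤ→ℚ b → a ℤ.≤ b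
  ℤ→ℚ-cancel-≤ {a} {b} a≤b with ℚᵘ.≤-respʳ-≃ (toℚᵘ-ℤ→ℚ b) (ℚᵘ.≤-respˡ-≃ (toℚᵘ-ℤ→ℚ a) (ℚ.toℚᵘ-mono-≤ a≤b))
  ... | ℚᵘ.*≤* a*1≤b*1 = subst₂ ℤ._≤_ (ℤ.*-identityʳ a) (ℤ.*-identityʳ b) a*1≤b*1

  b2q≡ℤ→ℚ-χ : ∀ b → b2q b ≡ ℤ→ℚ (χ b)
  b2q≡ℤ→ℚ-χ true  = refl
  b2q≡ℤ→ℚ-χ false = refl

  vectorOf : ∀ m → (ℕ → ℤ) → Vect m
  vectorOf m φ i = ℤ→ℚ (φ (suc (toℕ i)))

  boolVector : ∀ m → (ℕ → Bool) → Vect m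
  boolVector m t i = b2q (t (suc (toℕ i)))

  matrixOf : ∀ m → (ℕ → ℕ → Bool) → Mat m
  matrixOf m c i k = b2q (c (suc (toℕ i)) (suc (toℕ k)))

  SV-vectorOf : ∀ m (φ : ℕ → ℤ) → SV (vectorOf m φ) ≡ ℤ→ℚ (∑ m φ)
  SV-vectorOf zero    φ = refl
  SV-vectorOf (suc m) φ = begin
    SV (vectorOf (suc m) φ)                                              ≡⟨ Σℚ-init-last (vectorOf (suc m) φ) ⟩
    Σℚ {m} (λ i → ℤ→ℚ (φ (suc (toℕ (inject₁ i))))) ℚ.+ ℤ→ℚ (φ (suc (toℕ (fromℕ m))))
      ≡⟨ cong₂ ℚ._+_ (Σℚ-cong {m} (λ i → cong (ℤ→ℚ ∘ φ ∘ suc) (Fin.toℕ-inject₁ i))) (cong (ℤ→ℚ ∘ φ ∘ suc) (Fin.toℕ-fromℕ m)) ⟩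
    SV (vectorOf m φ) ℚ.+ ℤ→ℚ (φ (suc m))                               ≡⟨ cong (ℚ._+ ℤ→ℚ (φ (suc m))) (SV-vectorOf m φ) ⟩
    ℤ→ℚ (∑ m φ) ℚ.+ ℤ→ℚ (φ (suc m))                                     ≡⟨ ℤ→ℚ-+ (∑ m φ) (φ (suc m)) ⟨
    ℤ→ℚ (∑ (suc m) φ)                                                   ∎
    where open ≡-Reasoning

  private
    ℤ→ℚ-*χ : ∀ a b → ℤ→ℚ a ℚ.* b2q b ≡ ℤ→ℚ (a ℤ.* χ b)
    ℤ→ℚ-*χ a b = trans (cong (ℤ→ℚ a ℚ.*_) (b2q≡ℤ→ℚ-χ b)) (sym (ℤ→ℚ-* a (χ b)))

  ∙-boolVector : ∀ m (g : ℕ → ℤ) (t : ℕ → Bool) → vectorOf m g ∙ boolVector m t ≡ ℤ→ℚ (∑ m (λ i → g i ℤ.* χ (t i)))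
  ∙-boolVector m g t = trans (Σℚ-cong {m} (λ i → ℤ→ℚ-*χ (g (suc (toℕ i))) (t (suc (toℕ i))))) (SV-vectorOf m (λ i → g i ℤ.* χ (t i)))

  ᵥ*-matrixOf : ∀ m (c : ℕ → ℕ → Bool) (h f : ℕ → ℤ) → (∀ {k} → 1 ℕ.≤ k → k ℕ.≤ m → ∑ m (λ i → h i ℤ.* χ (c i k)) ≡ f k) →
                vectorOf m h ᵥ* matrixOf m c ≗ vectorOf m f
  ᵥ*-matrixOf m c h f column k = begin
    Σℚ (λ i → vectorOf m h i ℚ.* matrixOf m c i k)               ≡⟨ Σℚ-cong {m} (λ i → ℤ→ℚ-*χ (h (suc (toℕ i))) (c (suc (toℕ i)) (suc (toℕ k)))) ⟩
    SV (vectorOf m (λ i → h i ℤ.* χ (c i (suc (toℕ k)))))        ≡⟨ SV-vectorOf m (λ i → h i ℤ.* χ (c i (suc (toℕ k)))) ⟩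
    ℤ→ℚ (∑ m (λ i → h i ℤ.* χ (c i (suc (toℕ k)))))              ≡⟨ cong ℤ→ℚ (column (s≤s z≤n) (Fin.toℕ<n k)) ⟩
    vectorOf m f k                                               ∎
    where open ≡-Reasoning

  b2q-zeroOne : ∀ b → b2q b ≡ 0ℚ ⊎ b2q b ≡ 1ℚ
  b2q-zeroOne true  = inj₂ refl
  b2q-zeroOne false = inj₁ refl

  matrixOf-unitUpperTriangular : ∀ m (c : ℕ → ℕ → Bool) → (∀ {k} → 1 ℕ.≤ k → k ℕ.≤ m → c k k ≡ true) →
                                 (∀ {i k} → 1 ℕ.≤ k → k ℕ.< i → i ℕ.≤ m → c i k ≡ false) → UnitUpperTriangular (matrixOf m c)
  matrixOf-unitUpperTriangular m c diagonal below = record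
    { diagonal = λ i → cong b2q (diagonal (s≤s z≤n) (Fin.toℕ<n i))
    ; upper    = λ i k k<i → cong b2q (below (s≤s z≤n) (s≤s k<i) (Fin.toℕ<n i))
    }


module Realisation where

  open import Data.Bool using (Bool)
  open import Data.Nat as ℕ using (ℕ; suc; _⊓_; z≤n; s≤s)
  import Data.Nat.Properties as ℕ
  open import Data.Integer as ℤ using (ℤ; +_; 1ℤ)
  import Data.Integer.Properties as ℤ
  import Data.Rational as ℚ
  open import Data.Product using (Σ; _,_; proj₁; proj₂)
  open import Relation.Binary.PropositionalEquality
  open Matrices
  open IntegerSums
  open ColumnSums
  open SubsetSums
  open FibonacciBounds
  open IntegerMatrices

  module _ {p r : ℕ} {c : ℕ → ℕ → Bool} (ext : Extension (suc p) r c) where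
    private
      q = suc p
      m = r ℕ.+ q

      uut : UnitUpperTriangular (matrixOf m c)
      uut = matrixOf-unitUpperTriangular m c (extension-diagonal ext) (extension-below ext)

      1≤⊓ : ∀ {k} → 1 ℕ.≤ k → 1 ℕ.≤ k ⊓ q
      1≤⊓ 1≤k = ℕ.⊓-glb 1≤k (s≤s z≤n)

      ηᵥ*C : vectorOf m (truncate q η) ᵥ* matrixOf m c ≗ ones
      ηᵥ*C = ᵥ*-matrixOf m c (truncate q η) (λ _ → 1ℤ) (λ 1≤k k≤m → trans (extension-colSum ext η 1≤k k≤m) (colSum-η (1≤⊓ 1≤k)))

      γᵥ*C : vectorOf m (truncate q γ) ᵥ* matrixOf m c ≗ vectorOf m (truncate q η)
      γᵥ*C = ᵥ*-matrixOf m c (truncate q γ) (truncate q η) (λ 1≤k k≤m → trans (extension-colSum ext γ 1≤k k≤m) (colSum-γ (1≤⊓ 1≤k)))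

    extension-SV-invSq : ∀ t → SV (invSq (matrixOf m c) (boolVector m t)) ≡ ℤ→ℚ (subsetSum m (truncate q γ) t)
    extension-SV-invSq t = trans (SV-invSq uut (vectorOf m (truncate q η)) (vectorOf m (truncate q γ)) ηᵥ*C γᵥ*C (boolVector m t))
                                 (∙-boolVector m (truncate q γ) t)

    extension-realisable : ∀ t → Realisable (suc m) (ℤ→ℚ (∑ m (truncate q η) ℤ.+ subsetSum m (truncate q γ) t))
    extension-realisable t = subst (Realisable (suc m)) value
      (bordered-realisable uut (λ i k → b2q-zeroOne _) (vectorOf m (truncate q η)) (vectorOf m (truncate q γ)) ηᵥ*C γᵥ*C (λ i → b2q-zeroOne _))
      where
      value : SV (vectorOf m (truncate q η)) ℚ.+ vectorOf m (truncate q γ) ∙ boolVector m t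
            ≡ ℤ→ℚ (∑ m (truncate q η) ℤ.+ subsetSum m (truncate q γ) t)
      value = trans (cong₂ ℚ._+_ (SV-vectorOf m (truncate q η)) (∙-boolVector m (truncate q γ) t))
                    (sym (ℤ→ℚ-+ (∑ m (truncate q η)) (subsetSum m (truncate q γ) t)))

    extension-interval : ∀ {s} → ∑ m (truncate q η) ℤ.+ ∑⁻ m (truncate q γ) ℤ.≤ s → s ℤ.≤ ∑ m (truncate q η) ℤ.+ ∑⁺ m (truncate q γ) →
                         Realisable (suc m) (ℤ→ℚ s)
    extension-interval {s} lo hi = realise (subsetSum-surjective-shifted (∑ m (truncate q η)) m (truncate q γ) (γ-truncated-complete (s≤s z≤n)) lo hi)
      where
      realise : Σ (ℕ → Bool) (λ t → ∑ m (truncate q η) ℤ.+ subsetSum m (truncate q γ) t ≡ s) → Realisable (suc m) (ℤ→ℚ s)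
      realise (t , value≡s) = subst (λ v → Realisable (suc m) (ℤ→ℚ v)) value≡s (extension-realisable t)

  module TwoFamilies {pᵤ rᵤ pₗ rₗ : ℕ} {cᵤ cₗ : ℕ → ℕ → Bool}
                     (upper : Extension (suc pᵤ) rᵤ cᵤ) (lower : Extension (suc pₗ) rₗ cₗ)
                     (same-size : rₗ ℕ.+ suc pₗ ≡ rᵤ ℕ.+ suc pᵤ) (F : ℕ)
                     (upper-base : ∑ (rᵤ ℕ.+ suc pᵤ) (truncate (suc pᵤ) η) ≡ + 2 ℤ.+ + F)
                     (lower-base : ∑ (rₗ ℕ.+ suc pₗ) (truncate (suc pₗ) η) ≡ + 2 ℤ.- + F)
                     (adjacent : (+ 2 ℤ.+ + F) ℤ.+ ∑⁻ (rᵤ ℕ.+ suc pᵤ) (truncate (suc pᵤ) γ)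
                                 ℤ.≤ (+ 2 ℤ.- + F) ℤ.+ ∑⁺ (rₗ ℕ.+ suc pₗ) (truncate (suc pₗ) γ) ℤ.+ 1ℤ)
                     where
    private
      mᵤ = rᵤ ℕ.+ suc pᵤ
      mₗ = rₗ ℕ.+ suc pₗ
      γᵤ = truncate (suc pᵤ) γ
      γₗ = truncate (suc pₗ) γ
      U = + 2 ℤ.+ + F
      L = + 2 ℤ.- + F

      lower-interval : ∀ {s} → L ℤ.+ ∑⁻ mₗ γₗ ℤ.≤ s → s ℤ.≤ L ℤ.+ ∑⁺ mₗ γₗ → Realisable (suc mᵤ) (ℤ→ℚ s)
      lower-interval {s} lo hi = subst (λ n → Realisable n (ℤ→ℚ s)) (cong suc same-size)
        (extension-interval lower (subst (λ b → b ℤ.+ ∑⁻ mₗ γₗ ℤ.≤ s) (sym lower-base) lo)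
                                  (subst (λ b → s ℤ.≤ b ℤ.+ ∑⁺ mₗ γₗ) (sym lower-base) hi))

      upper-interval : ∀ {s} → U ℤ.+ ∑⁻ mᵤ γᵤ ℤ.≤ s → s ℤ.≤ U ℤ.+ ∑⁺ mᵤ γᵤ → Realisable (suc mᵤ) (ℤ→ℚ s)
      upper-interval {s} lo hi = extension-interval upper (subst (λ b → b ℤ.+ ∑⁻ mᵤ γᵤ ℤ.≤ s) (sym upper-base) lo)
                                                          (subst (λ b → s ℤ.≤ b ℤ.+ ∑⁺ mᵤ γᵤ) (sym upper-base) hi)

    realisable : ∀ {s} tᵤ tₗ →
      (ℕ→ℚ 2 ℚ.- ℕ→ℚ F) ℚ.- ℚ.- SV (invSq (matrixOf mₗ cₗ) (boolVector mₗ tₗ)) ℚ.≤ ℤ→ℚ s →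
      ℤ→ℚ s ℚ.≤ (ℕ→ℚ 2 ℚ.+ ℕ→ℚ F) ℚ.+ SV (invSq (matrixOf mᵤ cᵤ) (boolVector mᵤ tᵤ)) →
      Realisable (suc mᵤ) (ℤ→ℚ s)
    realisable {s} tᵤ tₗ lo hi = interval-union lower-interval upper-interval adjacent
      (ℤ.≤-trans (ℤ.+-monoʳ-≤ L (proj₁ (subsetSum-bounds mₗ γₗ tₗ))) lo′)
      (ℤ.≤-trans hi′ (ℤ.+-monoʳ-≤ U (proj₂ (subsetSum-bounds mᵤ γᵤ tᵤ))))
      where
      lo′ : L ℤ.+ subsetSum mₗ γₗ tₗ ℤ.≤ s
      lo′ = subst (ℤ._≤ s) (cong (λ y → L ℤ.+ y) (ℤ.neg-involutive (subsetSum mₗ γₗ tₗ))) (ℤ→ℚ-cancel-≤ (subst (ℚ._≤ ℤ→ℚ s) value lo))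
        where
        x = subsetSum mₗ γₗ tₗ
        value : (ℕ→ℚ 2 ℚ.- ℕ→ℚ F) ℚ.- ℚ.- SV (invSq (matrixOf mₗ cₗ) (boolVector mₗ tₗ)) ≡ ℤ→ℚ (L ℤ.- ℤ.- x)
        value = begin
          (ℕ→ℚ 2 ℚ.- ℕ→ℚ F) ℚ.- ℚ.- SV (invSq (matrixOf mₗ cₗ) (boolVector mₗ tₗ))
            ≡⟨ cong₂ (λ a b → a ℚ.- ℚ.- b) (sym (ℤ→ℚ-minus (+ 2) (+ F))) (extension-SV-invSq lower tₗ) ⟩
          ℤ→ℚ L ℚ.- ℚ.- ℤ→ℚ x    ≡⟨ cong (λ b → ℤ→ℚ L ℚ.- b) (ℤ→ℚ-neg x) ⟨
          ℤ→ℚ L ℚ.- ℤ→ℚ (ℤ.- x)  ≡⟨ ℤ→ℚ-minus L (ℤ.- x) ⟨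
          ℤ→ℚ (L ℤ.- ℤ.- x)      ∎
          where open ≡-Reasoning
      hi′ : s ℤ.≤ U ℤ.+ subsetSum mᵤ γᵤ tᵤ
      hi′ = ℤ→ℚ-cancel-≤ (subst (ℤ→ℚ s ℚ.≤_) value hi)
        where
        value : (ℕ→ℚ 2 ℚ.+ ℕ→ℚ F) ℚ.+ SV (invSq (matrixOf mᵤ cᵤ) (boolVector mᵤ tᵤ)) ≡ ℤ→ℚ (U ℤ.+ subsetSum mᵤ γᵤ tᵤ)
        value = trans (cong₂ ℚ._+_ (sym (ℤ→ℚ-+ (+ 2) (+ F))) (extension-SV-invSq upper tᵤ)) (sym (ℤ→ℚ-+ U (subsetSum mᵤ γᵤ tᵤ)))


module ConcreteMatrices where

  open import Data.Bool using (Bool; true; false; _∧_; _∨_; if_then_else_)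
  open import Data.Nat using (ℕ; zero; suc; _+_; _≤_; _<_; _≤ᵇ_; _≡ᵇ_; z≤n; s≤s)
  import Data.Nat.Properties as ℕ
  open import Data.Product using (_,_)
  open import Data.Sum using (inj₁; inj₂)
  open import Relation.Binary.PropositionalEquality
  open StandardPattern
  open ColumnSums
  open FibonacciBounds using (double)

  private
    variable
      i j k p : ℕ

  -- c1, …, c4 of Defs are definitionally of the form prefixed X Y rest.
  prefixed : ℕ → ℕ → Bool → ℕ → ℕ → Bool
  prefixed X Y rest k i =
    if k ≡ᵇ 1 then i ≡ᵇ 1 else
    if k ≡ᵇ 2 then i ≡ᵇ 2 else
    if isOdd k ∧ btw 3 X k then colA k i else
    if isEven k ∧ btw 4 Y k then colB k i else rest

  prefixed-standard : ∀ {X Y} rest i → 1 ≤ k → (isOdd k ≡ true → k ≤ X) → (isEven k ≡ true → k ≤ Y) →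
                      prefixed X Y rest k i ≡ standard k i
  prefixed-standard {1} rest i _ _ _ = refl
  prefixed-standard {2} rest i _ _ _ = refl
  prefixed-standard {k@(suc (suc (suc k′)))} {X} {Y} rest i _ odd⇒≤X even⇒≤Y with parity k
  ... | inj₁ (odd , _) = trans (if-true (∧≡true odd (≤⇒≤ᵇ-true (odd⇒≤X odd)))) (sym (if-true odd))
  prefixed-standard {3} rest i _ _ _ | inj₂ (() , _)
  prefixed-standard {k@(suc (suc (suc (suc k″))))} {X} {Y} rest i _ _ even⇒≤Y | inj₂ (not-odd , even) =
    trans (if-false (∧≡falseˡ not-odd (k ≤ᵇ X))) (trans (if-true (∧≡true even (≤⇒≤ᵇ-true (even⇒≤Y even)))) (sym (if-false not-odd)))

  prefixed-rest : ∀ {X Y} rest i → 3 ≤ k → X < k → Y < k → prefixed X Y rest k i ≡ rest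
  prefixed-rest {1} _ _ (s≤s ()) _ _
  prefixed-rest {2} _ _ (s≤s (s≤s ())) _ _
  prefixed-rest {k@(suc (suc (suc k′)))} {X} {Y} rest i _ X<k Y<k =
    trans (if-false (∧≡falseʳ (isOdd k) (>⇒≤ᵇ-false X<k))) (if-false (∧≡falseʳ (isEven k) (∧≡falseʳ (4 ≤ᵇ k) (>⇒≤ᵇ-false Y<k))))

  copyOfEvenColumn copyOfOddColumn : ℕ → ℕ → ℕ → Bool
  copyOfEvenColumn p k i = oddRange 3 p i ∨ (i ≡ᵇ k)
  copyOfOddColumn  p k i = (i ≡ᵇ 1) ∨ evenRange 2 p i ∨ (i ≡ᵇ k)

  private
    standard-odd : ∀ {q} → 3 ≤ q → isOdd q ≡ true → standard q i ≡ colA q i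
    standard-odd {q = suc (suc (suc _))} _ odd = if-true odd
    standard-odd {q = 1} (s≤s ()) _

    standard-even : ∀ {q} → 3 ≤ q → isOdd q ≡ false → standard q i ≡ colB q i
    standard-even {q = suc (suc (suc _))} _ not-odd = if-false not-odd
    standard-even {q = 2} (s≤s (s≤s ())) _

    ≡ᵇ-agree : i < suc p → suc p < k → (i ≡ᵇ k) ≡ (i ≡ᵇ suc p)
    ≡ᵇ-agree i<q q<k = trans (<⇒≡ᵇ-false (ℕ.<-trans i<q q<k)) (sym (<⇒≡ᵇ-false i<q))

  copyOfEvenColumn-above : 2 ≤ p → isOdd (suc p) ≡ false → i < suc p → suc p < k → copyOfEvenColumn p k i ≡ standard (suc p) i
  copyOfEvenColumn-above {p} {i} 2≤p not-odd i<q q<k =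
    trans (cong (oddRange 3 p i ∨_) (≡ᵇ-agree i<q q<k)) (sym (standard-even (s≤s 2≤p) not-odd))

  copyOfOddColumn-above : 2 ≤ p → isOdd (suc p) ≡ true → i < suc p → suc p < k → copyOfOddColumn p k i ≡ standard (suc p) i
  copyOfOddColumn-above {p} {i} 2≤p odd i<q q<k =
    trans (cong (λ b → (i ≡ᵇ 1) ∨ evenRange 2 p i ∨ b) (≡ᵇ-agree i<q q<k)) (sym (standard-odd (s≤s 2≤p) odd))

  copyOfEvenColumn-block : suc p ≤ i → copyOfEvenColumn p k i ≡ (i ≡ᵇ k)
  copyOfEvenColumn-block {p} {i} {k} p<i = cong (_∨ (i ≡ᵇ k)) (∧≡falseʳ (isOdd i) (∧≡falseʳ (3 ≤ᵇ i) (>⇒≤ᵇ-false p<i)))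

  copyOfOddColumn-block : 1 ≤ p → suc p ≤ i → copyOfOddColumn p k i ≡ (i ≡ᵇ k)
  copyOfOddColumn-block {p} {i} {k} 1≤p p<i =
    cong₂ (λ a b → a ∨ b ∨ (i ≡ᵇ k)) (>⇒≡ᵇ-false (ℕ.≤-trans (s≤s 1≤p) p<i)) (∧≡falseʳ (isEven i) (∧≡falseʳ (2 ≤ᵇ i) (>⇒≤ᵇ-false p<i)))

  ≤-by-parity : ∀ {k l} (parityOf : ℕ → Bool) → k ≤ suc l → parityOf k ≡ true → parityOf (suc l) ≡ false → k ≤ l
  ≤-by-parity parityOf k≤1+l k-true 1+l-false = ℕ.≤-pred (ℕ.≤∧≢⇒< k≤1+l (λ { refl → true≢false (trans (sym k-true) 1+l-false) }))
    where
    true≢false : true ≢ false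
    true≢false ()

  isOdd-double : ∀ t → isOdd (double t) ≡ false
  isOdd-double zero    = refl
  isOdd-double (suc t) = isOdd-double t

  isEven-double : ∀ t → isEven (double t) ≡ true
  isEven-double zero    = refl
  isEven-double (suc t) = isEven-double t

  module _ (t : ℕ) where
    private
      d = double t
      odd : isOdd (suc d) ≡ true
      odd = trans (isOdd-suc d) (isEven-double t)
      not-even : isEven (suc d) ≡ false
      not-even = trans (isEven-suc d) (isOdd-double t)
      2≤2+d : 2 ≤ 2 + d
      2≤2+d = s≤s (s≤s z≤n)
      3≤3+d : 3 ≤ 3 + d
      3≤3+d = s≤s 2≤2+d
      <+2 : ∀ {x} → x < 2 + x
      <+2 = ℕ.<-trans (ℕ.n<1+n _) (ℕ.n<1+n _)

    c1-extension : Extension (4 + d) 1 (c1 (6 + d))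
    c1-extension = extension-from-copies (copyOfEvenColumn (3 + d))
      (λ i 1≤k k≤q → prefixed-standard _ i 1≤k (λ odd → ≤-by-parity isOdd k≤q odd (isOdd-double t)) (λ _ → k≤q))
      (λ { i {1} _ _ → trans (prefixed-rest _ i (ℕ.≤-trans 3≤3+d (ℕ.m≤n+m _ 2)) <+2 (ℕ.n<1+n _)) (if-true (≡ᵇ-refl d))
         ; i {suc (suc _)} _ (s≤s ()) })
      (copyOfEvenColumn-above (ℕ.≤-trans 2≤2+d (ℕ.n≤1+n _)) (isOdd-double t))
      copyOfEvenColumn-block

    c2-extension : Extension (4 + d) 2 (c2 (7 + d))
    c2-extension = extension-from-copies (copyOfEvenColumn (3 + d))
      (λ i 1≤k k≤q → prefixed-standard _ i 1≤k (λ odd → ≤-by-parity isOdd k≤q odd (isOdd-double t)) (λ _ → k≤q))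
      (λ { i {1} _ _ → trans (prefixed-rest _ i (ℕ.≤-trans 3≤3+d (ℕ.m≤n+m _ 2)) <+2 (ℕ.n<1+n _)) (if-true (≡ᵇ-refl d))
         ; i {2} _ _ → trans (prefixed-rest _ i (ℕ.≤-trans 3≤3+d (ℕ.m≤n+m _ 3)) (ℕ.<-trans <+2 (ℕ.n<1+n _)) <+2)
                             (trans (if-false (>⇒≡ᵇ-false (ℕ.n<1+n (5 + d)))) (if-true (≡ᵇ-refl d)))
         ; i {suc (suc (suc _))} _ (s≤s (s≤s ())) })
      (copyOfEvenColumn-above (ℕ.≤-trans 2≤2+d (ℕ.n≤1+n _)) (isOdd-double t))
      copyOfEvenColumn-block

    c3-extension : Extension (3 + d) 2 (c3 (6 + d))
    c3-extension = extension-from-copies (copyOfOddColumn (2 + d))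
      (λ i 1≤k k≤q → prefixed-standard _ i 1≤k (λ _ → k≤q) (λ even → ≤-by-parity isEven k≤q even not-even))
      (λ { i {1} _ _ → trans (prefixed-rest _ i (ℕ.≤-trans 3≤3+d (ℕ.n≤1+n _)) (ℕ.n<1+n _) <+2) (if-true (≡ᵇ-refl d))
         ; i {2} _ _ → trans (prefixed-rest _ i (ℕ.≤-trans 3≤3+d (ℕ.m≤n+m _ 2)) <+2 (ℕ.<-trans <+2 (ℕ.n<1+n _)))
                             (trans (if-false (>⇒≡ᵇ-false (ℕ.n<1+n (4 + d)))) (if-true (≡ᵇ-refl d)))
         ; i {suc (suc (suc _))} _ (s≤s (s≤s ())) })
      (copyOfOddColumn-above 2≤2+d odd)
      (copyOfOddColumn-block (s≤s z≤n))

    c4-extension : Extension (5 + d) 1 (c4 (7 + d))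
    c4-extension = extension-from-copies (copyOfOddColumn (4 + d))
      (λ i 1≤k k≤q → prefixed-standard _ i 1≤k (λ _ → k≤q) (λ even → ≤-by-parity isEven k≤q even not-even))
      (λ { i {1} _ _ → trans (prefixed-rest _ i (ℕ.≤-trans 3≤3+d (ℕ.m≤n+m _ 3)) (ℕ.n<1+n _) <+2) (if-true (≡ᵇ-refl d))
         ; i {suc (suc _)} _ (s≤s ()) })
      (copyOfOddColumn-above (ℕ.≤-trans 2≤2+d (ℕ.m≤n+m _ 2)) odd)
      (copyOfOddColumn-block (s≤s z≤n))


module Cases where

  open import Data.Bool using (_∨_)
  open import Data.Nat as ℕ using (ℕ; zero; suc; _%_; _≡ᵇ_; _∸_)
  import Data.Nat.Properties as ℕ
  open import Data.Nat.Divisibility using (_∣_; n∣m⇒m%n≡0; m%n≡0⇒n∣m)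
  open import Data.Integer as ℤ using (+_; _+_; _-_; -_)
  import Data.Integer.Properties as ℤ
  open import Data.Integer.Tactic.RingSolver using (solve-∀)
  import Data.Rational as ℚ
  open import Data.Product using (Σ; _,_)
  open import Data.Sum using (inj₁; inj₂)
  open import Relation.Binary.PropositionalEquality
  open import Relation.Nullary using (¬_; contradiction)
  open Matrices using (Realisable)
  open IntegerSums
  open ColumnSums
  open FibonacciBounds
  open ConcreteMatrices
  open Realisation

  private
    plus-fib : ∀ a b → + 2 + + a + + b ≡ + 2 + + (a ℕ.+ b)
    plus-fib a b = trans (ℤ.+-assoc (+ 2) (+ a) (+ b)) (cong (λ x → + 2 + x) (sym (ℤ.pos-+ a b)))

    minus-fib : ∀ a b → + 2 - + a + - + b ≡ + 2 - + (a ℕ.+ b)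
    minus-fib a b = trans (identity (+ a) (+ b)) (cong (λ x → + 2 - x) (sym (ℤ.pos-+ a b)))
      where
      identity : ∀ x y → + 2 - x + - y ≡ + 2 - (x + y)
      identity = solve-∀

  module _ (t : ℕ) where

    even-case : ∀ s →
      ((ℕ→ℚ 2 ℚ.- ℕ→ℚ (fib (6 ℕ.+ double t ∸ 2))) ℚ.- qₙ (6 ℕ.+ double t)) ℚ.≤ ℤ→ℚ s →
      ℤ→ℚ s ℚ.≤ ((ℕ→ℚ 2 ℚ.+ ℕ→ℚ (fib (6 ℕ.+ double t ∸ 2))) ℚ.+ pₙ (6 ℕ.+ double t)) →
      Realisable (6 ℕ.+ double t) (ℤ→ℚ s)
    even-case s = TwoFamilies.realisable (c1-extension t) (c3-extension t) refl (fib (6 ℕ.+ double t ∸ 2))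
      (trans (∑-truncated-1 (4 ℕ.+ double t) η) (η-partial-even (suc t)))
      (trans (∑-truncated-2 (3 ℕ.+ double t) η)
             (trans (cong₂ _+_ (η-partial-odd t) (η-odd t)) (minus-fib (fib (3 ℕ.+ double t)) (fib (2 ℕ.+ double t)))))
      (families-adjacent {q₀ = 3 ℕ.+ double t} (fib (4 ℕ.+ double t)) (ℕ.n≤1+n _) ℕ.≤-refl (ℕ.m≤n+m _ 2) (ℕ.m≤n+m _ 2)
                         (double-fib≤1+∑α (double t))) {s}
      -- the supports of uⁿ and wⁿ
      (λ i → (i ≡ᵇ 1) ∨ evenRange 2 (4 ℕ.+ double t) i ∨ (i ≡ᵇ 5 ℕ.+ double t))
      (λ i → oddRange 3 (3 ℕ.+ double t) i ∨ (i ≡ᵇ 4 ℕ.+ double t) ∨ (i ≡ᵇ 5 ℕ.+ double t))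

    odd-case : ∀ s →
      ((ℕ→ℚ 2 ℚ.- ℕ→ℚ (fib (7 ℕ.+ double t ∸ 2))) ℚ.- sₙ (7 ℕ.+ double t)) ℚ.≤ ℤ→ℚ s →
      ℤ→ℚ s ℚ.≤ ((ℕ→ℚ 2 ℚ.+ ℕ→ℚ (fib (7 ℕ.+ double t ∸ 2))) ℚ.+ rₙ (7 ℕ.+ double t)) →
      Realisable (7 ℕ.+ double t) (ℤ→ℚ s)
    odd-case s = TwoFamilies.realisable (c2-extension t) (c4-extension t) refl (fib (7 ℕ.+ double t ∸ 2))
      (trans (∑-truncated-2 (4 ℕ.+ double t) η)
             (trans (cong₂ _+_ (η-partial-even (suc t)) (η-even (suc t))) (plus-fib (fib (4 ℕ.+ double t)) (fib (3 ℕ.+ double t)))))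
      (trans (∑-truncated-1 (5 ℕ.+ double t) η) (η-partial-odd (suc t)))
      (families-adjacent {q₀ = 4 ℕ.+ double t} (fib (5 ℕ.+ double t)) ℕ.≤-refl (ℕ.n≤1+n _) (ℕ.m≤n+m _ 2) (ℕ.m≤n+m _ 2)
                         (double-fib≤1+∑α (suc (double t)))) {s}
      -- the supports of vⁿ and zⁿ
      (λ i → (i ≡ᵇ 1) ∨ evenRange 2 (4 ℕ.+ double t) i ∨ (i ≡ᵇ 5 ℕ.+ double t) ∨ (i ≡ᵇ 6 ℕ.+ double t))
      (λ i → oddRange 3 (5 ℕ.+ double t) i ∨ (i ≡ᵇ 6 ℕ.+ double t))

  private
    double%2 : ∀ t → double t % 2 ≡ 0
    double%2 zero    = refl
    double%2 (suc t) = double%2 t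

    suc-double%2 : ∀ t → suc (double t) % 2 ≡ 1
    suc-double%2 zero    = refl
    suc-double%2 (suc t) = suc-double%2 t

  2∣double : ∀ t → 2 ∣ double t
  2∣double t = m%n≡0⇒n∣m (double t) 2 (double%2 t)

  2∤1+double : ∀ t → ¬ (2 ∣ suc (double t))
  2∤1+double t 2∣1+double = contradiction (trans (sym (suc-double%2 t)) (n∣m⇒m%n≡0 (suc (double t)) 2 2∣1+double)) λ ()

  even-form : ∀ {n} → 2 ∣ n → 6 ℕ.≤ n → Σ ℕ (λ t → n ≡ 6 ℕ.+ double t)
  even-form 2∣n 6≤n with ℕ.m≤n⇒∃[o]m+o≡n 6≤n
  ... | k , refl with double-or-odd k
  ...   | t , inj₁ refl = t , refl
  ...   | t , inj₂ refl = contradiction 2∣n (2∤1+double (3 ℕ.+ t))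

  odd-form : ∀ {n} → ¬ (2 ∣ n) → 6 ℕ.≤ n → Σ ℕ (λ t → n ≡ 7 ℕ.+ double t)
  odd-form 2∤n 6≤n with ℕ.m≤n⇒∃[o]m+o≡n 6≤n
  ... | k , refl with double-or-odd k
  ...   | t , inj₂ refl = t , refl
  ...   | t , inj₁ refl = contradiction (2∣double (3 ℕ.+ t)) 2∤n


open Cases
open import Data.Nat using (ℕ; _≤_; _∸_)
open import Data.Nat.Divisibility using (_∣_)
open import Data.Integer using (ℤ)
open import Data.Rational using (ℚ; _+_; _-_) renaming (_≤_ to _≤ℚ_)
open import Data.Product using (Σ; _×_; _,_)
open import Data.Sum using (_⊎_; inj₁; inj₂)
open import Relation.Binary.PropositionalEquality using (_≡_; refl)
open import Relation.Nullary using (¬_)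

theorem3p1 : (n : ℕ) (s : ℤ) → 6 ≤ n →
  ((2 ∣ n) × ((ℕ→ℚ 2 - ℕ→ℚ (fib (n ∸ 2))) - qₙ n) ≤ℚ ℤ→ℚ s × ℤ→ℚ s ≤ℚ ((ℕ→ℚ 2 + ℕ→ℚ (fib (n ∸ 2))) + pₙ n))
  ⊎ ((¬ (2 ∣ n)) × ((ℕ→ℚ 2 - ℕ→ℚ (fib (n ∸ 2))) - sₙ n) ≤ℚ ℤ→ℚ s × ℤ→ℚ s ≤ℚ ((ℕ→ℚ 2 + ℕ→ℚ (fib (n ∸ 2))) + rₙ n)) →
  Σ (Mat n) (λ A → ZeroOne A × UpperTriangular A × Singular A ×
    Σ (Mat n) (λ X → IsGroupInverse A X × SM X ≡ ℤ→ℚ s))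
theorem3p1 n s 6≤n (inj₁ (2∣n , lo , hi)) with even-form 2∣n 6≤n
... | t , refl = even-case t s lo hi
theorem3p1 n s 6≤n (inj₂ (2∤n , lo , hi)) with odd-form 2∤n 6≤n
... | t , refl = odd-case t s lo hi
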